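{- Let $p$ be a prime. Let $A=(a_1,\dots,a_\ell)$, $B=(b_1,\dots,b_\ell)$ be sequences of $\ell\geqslant1$ elements of $\mathbb{F}_p$ with all $a_i$ nonzero and $\mathcal{S}_A\subseteq\mathcal{S}_B$. Let $\lambda_1,\dots,\lambda_d$ be the ratios associated with $(A,B)$, with corresponding subsequences $S_1,\dots,S_d$ and ratio sets $\Sigma_1,\dots,\Sigma_d$, and assume $d\geqslant2$. Given two distinct $i_0,j_0\in[1,d]$ and a term $r_{i_0}$ of $S_{i_0}$, define $\Sigma'_{i_0}=\Sigma(S_{i_0}\setminus(r_{i_0}))$ (one occurrence of $r_{i_0}$ removed), $\Sigma'_{j_0}=\Sigma(S_{j_0}\cup(r_{i_0}))=\Sigma_{j_0}+\{0,r_{i_0}\}$, and $\Sigma'_i=\Sigma_i$ for $i\notin\{i_0,j_0\}$. Then the polynomial $$Q_{i_0,j_0}(X_1,\dots,X_d)=\Big(\sum_{i=1}^d\lambda_iX_i\Big)\Big(\sum_{i=1}^d\lambda_iX_i-\chi\Big)\Big(\Big(\sum_{i=1}^dX_i\Big)^{p-1}-1\Big),\quad \chi=(\lambda_{j_0}-\lambda_{i_0})r_{i_0},$$ vanishes on $\prod_{i=1}^d\Sigma'_i$. Moreover, the coefficient in $Q_{i_0,j_0}$ of a monomial $\prod_{i=1}^dX_i^{t_i}$ with $\sum_{i=1}^dt_i=p+1$ and $\max_i t_i<p$ equals $$\frac{(p-1)!}{\prod_{i=1}^dt_i!}\left(\Big(\sum_{i=1}^d\lambda_it_i\Big)^2-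\sum_{i=1}^d\lambda_i^2t_i\right).$$
   Context: For a sequence $C=(c_1,\dots,c_\ell)$, $\mathcal{S}_C=\{x\in\{0,1\}^\ell : \sum_i c_ix_i=0 \text{ in } \mathbb{F}_p\}$. For a sequence $S=(s_1,\dots,s_k)$ over $\mathbb{F}_p$, $\Sigma(S)=\{\sum_{i\in J}s_i : J\subseteq[1,k]\}$. For $\lambda\in\mathbb{F}_p$ let $I_\lambda=\{i : b_i/a_i=\lambda\}$; the ratios associated with $(A,B)$ are the distinct $\lambda_1,\dots,\lambda_d$ with $I_{\lambda_i}\neq\emptyset$, $S_i=(a_j : j\in I_{\lambda_i})$, and $\Sigma_i=\Sigma(S_i)$. -}

module Defs where

open import Data.Nat as ℕ using (ℕ; zero; suc)
open import Data.Nat.Primality using (Prime)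
open import Data.Integer as ℤ using (ℤ; +_; _+_; _*_; _-_; -_)
open import Data.Integer.Divisibility using (_∣_)
open import Data.Fin using (Fin; zero; suc; _≟_)
open import Data.Bool using (Bool; true; false; if_then_else_)
open import Data.Vec as Vec using (Vec; []; _∷_; lookup; replicate; zipWith)
import Data.Vec.Properties as VecP
open import Data.List as List using (List; []; _∷_; _++_; concatMap; map)
open import Data.Product using (_×_; _,_; Σ; ∃; ∃-syntax)
open import Data.Sum using (_⊎_)
open import Relation.Nullary using (¬_; yes; no)
open import Relation.Binary.PropositionalEquality using (_≡_; _≢_)

-- The prime field F_p, modelled as ℤ modulo the congruence  x ≡ y (mod p).

infix 4 _≡[_]_
_≡[_]_ : ℤ → ℕ → ℤ → Set
x ≡[ p ] y = (+ p) ∣ (x - y)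

-- Division in F_p:  c = u / v  (v nonzero mod p)  means  c · v = u  in F_p.
IsQuot : ℕ → ℤ → ℤ → ℤ → Set
IsQuot p c u v = c * v ≡[ p ] u

sumF : {n : ℕ} → (Fin n → ℤ) → ℤ
sumF {zero}  f = + 0
sumF {suc n} f = f zero + sumF (λ i → f (suc i))

prodF : {n : ℕ} → (Fin n → ℤ) → ℤ
prodF {zero}  f = + 1
prodF {suc n} f = f zero * prodF (λ i → f (suc i))

sumℕ : {n : ℕ} → Vec ℕ n → ℕ
sumℕ [] = 0
sumℕ (x ∷ xs) = x ℕ.+ sumℕ xs

fact : ℕ → ℕ
fact zero = 1
fact (suc n) = suc n ℕ.* fact n

_^ℤ_ : ℤ → ℕ → ℤ
x ^ℤ zero = + 1
x ^ℤ suc n = x * (x ^ℤ n)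

bitSum : {ℓ : ℕ} → (Fin ℓ → ℤ) → (Fin ℓ → Bool) → ℤ
bitSum c x = sumF (λ i → if x i then c i else + 0)

InS : (p : ℕ) {ℓ : ℕ} → (Fin ℓ → ℤ) → (Fin ℓ → Bool) → Set
InS p c x = bitSum c x ≡[ p ] + 0

-- A subsequence of (a_1,…,a_ℓ) is given by a predicate I on the index set.
-- Σ(S) for S = (a_j : j ∈ I) is the set of sums over sub-index-sets J ⊆ I;
-- membership of s in Σ(S) (as an element of F_p):
InSubsetSums : (p : ℕ) {ℓ : ℕ} → (Fin ℓ → ℤ) → (Fin ℓ → Set) → ℤ → Set
InSubsetSums p a I s =
  ∃[ J ] ((∀ j → J j ≡ true → I j) × (s ≡[ p ] bitSum a J))

-- I_λ = { j : b_j / a_j = λ }  (a_j ≠ 0 in F_p, so this is b_j = λ a_j).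
Iλ : (p : ℕ) {ℓ : ℕ} → (Fin ℓ → ℤ) → (Fin ℓ → ℤ) → ℤ → Fin ℓ → Set
Iλ p a b λ' j = b j ≡[ p ] λ' * a j

IsRatios : (p : ℕ) {ℓ d : ℕ} → (Fin ℓ → ℤ) → (Fin ℓ → ℤ) → (Fin d → ℤ) → Set
IsRatios p a b lam =
  (∀ i j → i ≢ j → ¬ (lam i ≡[ p ] lam j)) ×
  (∀ i → ∃[ j ] Iλ p a b (lam i) j) ×
  (∀ (μ : ℤ) j → Iλ p a b μ j → ∃[ i ] (μ ≡[ p ] lam i))

-- Index sets of the modified subsequences S'_i, where r_{i0} = a_k:
--   S'_{i0} = S_{i0} \ (a_k),  S'_{j0} = S_{j0} ∪ (a_k),  S'_i = S_i otherwise.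
I' : (p : ℕ) {ℓ d : ℕ} → (Fin ℓ → ℤ) → (Fin ℓ → ℤ) → (Fin d → ℤ) →
     (i0 j0 : Fin d) (k : Fin ℓ) → Fin d → Fin ℓ → Set
I' p a b lam i0 j0 k i j with i ≟ i0 | i ≟ j0
... | yes _ | _     = Iλ p a b (lam i) j × j ≢ k
... | no _  | yes _ = Iλ p a b (lam i) j ⊎ j ≡ k
... | no _  | no _  = Iλ p a b (lam i) j

-- Multivariate polynomials in X_1,…,X_d with integer coefficients
-- (reduced mod p when compared), as formal lists of terms
-- (coefficient, exponent vector).  Coefficients of equal monomials are
-- summed by `coeff`.

Poly : ℕ → Set
Poly d = List (ℤ × Vec ℕ d)

constP : {d : ℕ} → ℤ → Poly d
constP {d} c = (c , replicate d 0) ∷ []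

unitVec : {d : ℕ} → Fin d → Vec ℕ d
unitVec {suc d} zero    = 1 ∷ replicate d 0
unitVec {suc d} (suc i) = 0 ∷ unitVec i

varP : {d : ℕ} → Fin d → Poly d
varP i = (+ 1 , unitVec i) ∷ []

_+P_ : {d : ℕ} → Poly d → Poly d → Poly d
P +P Q = P ++ Q

scaleP : {d : ℕ} → ℤ → Poly d → Poly d
scaleP c P = map (λ { (c' , e) → (c * c' , e) }) P

_-P_ : {d : ℕ} → Poly d → Poly d → Poly d
P -P Q = P ++ scaleP (- + 1) Q

_*P_ : {d : ℕ} → Poly d → Poly d → Poly d
P *P Q = concatMap (λ { (c , e) → map (λ { (c' , e') → (c * c' , zipWith ℕ._+_ e e') }) Q }) P

_^P_ : {d : ℕ} → Poly d → ℕ → Poly d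
P ^P zero = constP (+ 1)
P ^P suc n = P *P (P ^P n)

sumP : {d n : ℕ} → (Fin n → Poly d) → Poly d
sumP {n = zero}  f = []
sumP {n = suc n} f = f zero +P sumP (λ i → f (suc i))

coeff : {d : ℕ} → Vec ℕ d → Poly d → ℤ
coeff t [] = + 0
coeff t ((c , e) ∷ P) with VecP.≡-dec ℕ._≟_ e t
... | yes _ = c + coeff t P
... | no _  = coeff t P

evalP : {d : ℕ} → (Fin d → ℤ) → Poly d → ℤ
evalP x [] = + 0
evalP x ((c , e) ∷ P) = c * prodF (λ i → x i ^ℤ lookup e i) + evalP x P

Qpoly : (p : ℕ) {d : ℕ} → (Fin d → ℤ) → ℤ → Poly d
Qpoly p lam χ =
  let L = sumP (λ i → scaleP (lam i) (varP i))
      S = sumP (λ i → varP i)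
  in (L *P (L -P constP χ)) *P ((S ^P (p ℕ.∸ 1)) -P constP (+ 1))

module Submission where

open import Defs
open import Data.Nat as ℕ using (ℕ; _≤_; _<_)
open import Data.Nat.Primality using (Prime)
open import Data.Integer as ℤ using (ℤ; +_; _+_; _*_; _-_)
open import Data.Fin using (Fin)
open import Data.Bool using (Bool)
open import Data.Vec using (Vec; lookup)
open import Data.Product using (_×_; _,_; ∃; ∃-syntax)
open import Relation.Nullary using (¬_)
open import Relation.Binary.PropositionalEquality using (_≡_; _≢_)

open import Data.Nat using (zero; suc; s≤s; z≤n; _!)
import Data.Nat.Properties as ℕP
open import Data.Nat.Primality using (euclidsLemma; prime⇒nonTrivial; prime⇒nonZero)
import Data.Nat.Divisibility as ℕD
open import Data.Integer using (-_; ∣_∣)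
import Data.Integer.Properties as ℤP
open import Data.Integer.Divisibility.Signed as SD using (divides; ∣ᵤ⇒∣; ∣⇒∣ᵤ)
open import Data.Integer.Tactic.RingSolver using (solve-∀)
open import Data.Fin using (zero; suc; _≟_)
import Data.Fin.Properties as FinP
open import Data.Vec using ([]; _∷_; replicate; zipWith)
import Data.Vec.Properties as VecP
open import Data.List using ([]; _∷_; _++_; map)
open import Data.Product using (proj₁; proj₂)
open import Data.Sum using (_⊎_; inj₁; inj₂)
open import Data.Bool using (true; false; if_then_else_; _∨_)
open import Data.Empty using (⊥-elim)
open import Function using (_∘_)
open import Relation.Nullary using (Dec; yes; no; map′)
open import Relation.Binary.Bundles using (Setoid)
open import Relation.Binary.PropositionalEquality using (refl; sym; trans; cong; cong₂; subst; module ≡-Reasoning)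
import Relation.Binary.Reasoning.Setoid as SetoidReasoning

-- Vanishing: write x_i as the subset sum of A over some J_i ⊆ I'_i.  The
-- modified classes I'_i are disjoint, so for J = ⋃ J_i we get S(x) = Σ_J a
-- and L(x) = Σ_J b + D with D ∈ {0, χ}.  If S(x) = 0 then J ∈ 𝒮_A ⊆ 𝒮_B, so
-- L(x) ∈ {0, χ}; otherwise S(x)^(p−1) = 1 by Fermat.  Either way Q(x) = 0.
--
-- Coefficients: t! · coeff_t(Q) = (p−1)! ((Σ λ_i t_i)² − Σ λ_i² t_i) holds
-- exactly over ℤ.  It is computed with the linear functionals
-- Φ_{m,t}(c X^e) = c (t)_e [|e| = m] built from falling factorials: Φ_{|t|,t}
-- extracts t! · coeff_t, multiplying by S only rescales Φ, hence
-- Φ_{|t|,t}(M S^(p−1)) = (p−1)! Φ_{2,t}(M) for M = L (L − χ), and Φ_{2,t}(L²)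
-- is expanded directly (CoefficientFunctional).

module Congruence (p : ℕ) where

  -- x ≈ y : congruence modulo p, i.e. equality in 𝔽_p.  A record, so that
  -- x and y can be inferred from a proof.
  infix 4 _≈_
  record _≈_ (x y : ℤ) : Set where
    constructor mod
    field p∣x-y : + p SD.∣ (x - y)
  open _≈_ public

  ≈⇒≡[p] : ∀ {x y} → x ≈ y → x ≡[ p ] y
  ≈⇒≡[p] (mod d) = ∣⇒∣ᵤ d

  ≡[p]⇒≈ : ∀ {x y} → x ≡[ p ] y → x ≈ y
  ≡[p]⇒≈ d = mod (∣ᵤ⇒∣ d)

  ∣⇒≈0 : ∀ {x} → + p SD.∣ x → x ≈ + 0
  ∣⇒≈0 {x} d = mod (subst (+ p SD.∣_) (sym (ℤP.+-identityʳ x)) d)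

  ≈0⇒∣ : ∀ {x} → x ≈ + 0 → + p SD.∣ x
  ≈0⇒∣ {x} (mod d) = subst (+ p SD.∣_) (ℤP.+-identityʳ x) d

  x-y≈0⇒x≈y : ∀ {x y} → x - y ≈ + 0 → x ≈ y
  x-y≈0⇒x≈y d = mod (≈0⇒∣ d)

  x≈y⇒x-y≈0 : ∀ {x y} → x ≈ y → x - y ≈ + 0
  x≈y⇒x-y≈0 d = ∣⇒≈0 (p∣x-y d)

  private
    along : ∀ {u v} → u ≡ v → + p SD.∣ u → + p SD.∣ v
    along = subst (+ p SD.∣_)

  ≡⇒≈ : ∀ {x y} → x ≡ y → x ≈ y
  ≡⇒≈ {x} refl = mod (divides (+ 0) (ℤP.+-inverseʳ x))

  ≈-refl : ∀ {x} → x ≈ x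
  ≈-refl = ≡⇒≈ refl

  ≈-sym : ∀ {x y} → x ≈ y → y ≈ x
  ≈-sym {x} {y} (mod d) = mod (along (law x y) (SD.∣m⇒∣-m d))
    where law : ∀ x y → - (x - y) ≡ y - x
          law = solve-∀

  ≈-trans : ∀ {x y z} → x ≈ y → y ≈ z → x ≈ z
  ≈-trans {x} {y} {z} (mod d) (mod e) = mod (along (law x y z) (SD.∣m∣n⇒∣m+n d e))
    where law : ∀ x y z → (x - y) + (y - z) ≡ x - z
          law = solve-∀

  ≈-setoid : Setoid _ _
  ≈-setoid = record
    { Carrier = ℤ ; _≈_ = _≈_
    ; isEquivalence = record { refl = ≈-refl ; sym = ≈-sym ; trans = ≈-trans } }

  +-cong : ∀ {x y u v} → x ≈ y → u ≈ v → x + u ≈ y + v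
  +-cong {x} {y} {u} {v} (mod d) (mod e) = mod (along (law x y u v) (SD.∣m∣n⇒∣m+n d e))
    where law : ∀ x y u v → (x - y) + (u - v) ≡ (x + u) - (y + v)
          law = solve-∀

  -‿cong : ∀ {x y} → x ≈ y → - x ≈ - y
  -‿cong {x} {y} (mod d) = mod (along (law x y) (SD.∣m⇒∣-m d))
    where law : ∀ x y → - (x - y) ≡ - x - - y
          law = solve-∀

  *-cong : ∀ {x y u v} → x ≈ y → u ≈ v → x * u ≈ y * v
  *-cong {x} {y} {u} {v} (mod d) (mod e) =
    mod (along (law x y u v) (SD.∣m∣n⇒∣m+n (SD.∣n⇒∣m*n u d) (SD.∣n⇒∣m*n y e)))
    where law : ∀ x y u v → u * (x - y) + y * (u - v) ≡ x * u - y * v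
          law = solve-∀

  -cong : ∀ {x y u v} → x ≈ y → u ≈ v → x - u ≈ y - v
  -cong d e = +-cong d (-‿cong e)

  ^-cong : ∀ {x y} n → x ≈ y → x ^ℤ n ≈ y ^ℤ n
  ^-cong zero    d = ≈-refl
  ^-cong (suc n) d = *-cong d (^-cong n d)

  *p≈0 : ∀ q → q * + p ≈ + 0
  *p≈0 q = ∣⇒≈0 (divides q refl)

  infix 4 _≈?_
  _≈?_ : ∀ x y → Dec (x ≈ y)
  x ≈? y = map′ mod p∣x-y (+ p SD.∣? (x - y))

  *≈0⇒ : Prime p → ∀ {x y} → x * y ≈ + 0 → x ≈ + 0 ⊎ y ≈ + 0
  *≈0⇒ p-prime {x} {y} xy≈0
    with euclidsLemma ∣ x ∣ ∣ y ∣ p-prime (subst (p ℕD.∣_) (ℤP.abs-* x y) (∣⇒∣ᵤ (≈0⇒∣ xy≈0)))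
  ... | inj₁ p∣x = inj₁ (∣⇒≈0 (∣ᵤ⇒∣ p∣x))
  ... | inj₂ p∣y = inj₂ (∣⇒≈0 (∣ᵤ⇒∣ p∣y))

  sumF-cong-≈ : ∀ {n} {f g : Fin n → ℤ} → (∀ i → f i ≈ g i) → sumF f ≈ sumF g
  sumF-cong-≈ {zero}  f≈g = ≈-refl
  sumF-cong-≈ {suc n} f≈g = +-cong (f≈g zero) (sumF-cong-≈ (λ i → f≈g (suc i)))

  bitSum-cong-≈ : ∀ {n} {c c' : Fin n → ℤ} (J : Fin n → Bool) →
                  (∀ j → J j ≡ true → c j ≈ c' j) → bitSum c J ≈ bitSum c' J
  bitSum-cong-≈ {c = c} {c'} J c≈c' = sumF-cong-≈ term
    where
    term : ∀ j → (if J j then c j else + 0) ≈ (if J j then c' j else + 0)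
    term j with J j in Jj
    ... | true  = c≈c' j Jj
    ... | false = ≈-refl

  root-product : ∀ u χ v → (u ≈ + 0 ⊎ u ≈ χ) ⊎ v ≈ + 0 → u * (u - χ) * v ≈ + 0
  root-product u χ v (inj₁ (inj₁ u≈0)) =
    ≈-trans (*-cong (*-cong u≈0 (≈-refl {u - χ})) (≈-refl {v})) (≡⇒≈ refl)
  root-product u χ v (inj₁ (inj₂ u≈χ)) =
    ≈-trans (*-cong (*-cong (≈-refl {u}) (≈-trans (-cong u≈χ (≈-refl {χ})) (≡⇒≈ (ℤP.+-inverseʳ χ))))
                    (≈-refl {v}))
            (≡⇒≈ (trans (cong (_* v) (ℤP.*-zeroʳ u)) refl))
  root-product u χ v (inj₂ v≈0) =
    ≈-trans (*-cong (≈-refl {u * (u - χ)}) v≈0) (≡⇒≈ (ℤP.*-zeroʳ (u * (u - χ))))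

module FiniteSums where
  open import Algebra.Properties.Semiring.Sum ℤP.+-*-semiring
    using (sum; ∑-distrib-+; ∑-comm; *-distribˡ-sum; sum-replicate-zero)

  -- sumF of the statement is the library's finite sum over Fin n; through
  -- this identification the standard summation laws become available.
  sumF≡sum : ∀ {n} (f : Fin n → ℤ) → sumF f ≡ sum f
  sumF≡sum {zero}  f = refl
  sumF≡sum {suc n} f = cong (_+_ (f zero)) (sumF≡sum (λ i → f (suc i)))

  sumF-cong : ∀ {n} {f g : Fin n → ℤ} → (∀ i → f i ≡ g i) → sumF f ≡ sumF g
  sumF-cong {zero}  f≡g = refl
  sumF-cong {suc n} f≡g = cong₂ _+_ (f≡g zero) (sumF-cong (λ i → f≡g (suc i)))

  sumF-0 : ∀ n → sumF {n} (λ _ → + 0) ≡ + 0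
  sumF-0 n = trans (sumF≡sum {n} (λ _ → + 0)) (sum-replicate-zero n)

  sumF-+ : ∀ {n} (f g : Fin n → ℤ) → sumF (λ i → f i + g i) ≡ sumF f + sumF g
  sumF-+ f g = trans (sumF≡sum (λ i → f i + g i))
    (trans (∑-distrib-+ f g) (sym (cong₂ _+_ (sumF≡sum f) (sumF≡sum g))))

  sumF-* : ∀ {n} c (f : Fin n → ℤ) → sumF (λ i → c * f i) ≡ c * sumF f
  sumF-* c f = trans (sumF≡sum (λ i → c * f i)) (sym (trans (cong (c *_) (sumF≡sum f)) (*-distribˡ-sum c f)))

  sumF-- : ∀ {n} (f g : Fin n → ℤ) → sumF (λ i → f i - g i) ≡ sumF f - sumF g
  sumF-- f g = trans (sumF-+ f (λ i → - g i))
    (cong (_+_ (sumF f)) (trans (sumF-cong (λ i → sym (ℤP.-1*i≡-i (g i))))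
                         (trans (sumF-* (- + 1) g) (ℤP.-1*i≡-i (sumF g)))))

  sumF-comm : ∀ {m n} (f : Fin m → Fin n → ℤ) →
              sumF (λ i → sumF (f i)) ≡ sumF (λ j → sumF (λ i → f i j))
  sumF-comm f = begin
    sumF (λ i → sumF (f i))              ≡⟨ sumF-cong (λ i → sumF≡sum (f i)) ⟩
    sumF (λ i → sum (f i))               ≡⟨ sumF≡sum (λ i → sum (f i)) ⟩
    sum (λ i → sum (f i))                ≡⟨ ∑-comm f ⟩
    sum (λ j → sum (λ i → f i j))        ≡⟨ sym (sumF≡sum (λ j → sum (λ i → f i j))) ⟩
    sumF (λ j → sum (λ i → f i j))       ≡⟨ sumF-cong (λ j → sym (sumF≡sum (λ i → f i j))) ⟩
    sumF (λ j → sumF (λ i → f i j))      ∎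
    where open ≡-Reasoning

  sumF-single : ∀ {n} (f : Fin n → ℤ) i* → (∀ i → i ≢ i* → f i ≡ + 0) → sumF f ≡ f i*
  sumF-single {suc n} f zero f≡0 =
    trans (cong (_+_ (f zero)) (trans (sumF-cong (λ i → f≡0 (suc i) (λ ()))) (sumF-0 n)))
          (ℤP.+-identityʳ (f zero))
  sumF-single {suc n} f (suc i*) f≡0 =
    trans (cong (_+ sumF (λ i → f (suc i))) (f≡0 zero (λ ())))
    (trans (ℤP.+-identityˡ _)
           (sumF-single (λ i → f (suc i)) i* (λ i i≢i* → f≡0 (suc i) (i≢i* ∘ FinP.suc-injective))))

  anyF : ∀ {n} → (Fin n → Bool) → Bool
  anyF {zero}  B = false
  anyF {suc n} B = B zero ∨ anyF (λ i → B (suc i))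

  sumF-at-most-one : ∀ {n} (B : Fin n → Bool) v →
                     (∀ i i' → B i ≡ true → B i' ≡ true → i ≡ i') →
                     sumF (λ i → if B i then v else + 0) ≡ (if anyF B then v else + 0)
  sumF-at-most-one {zero}  B v unique = refl
  sumF-at-most-one {suc n} B v unique with B zero in B0
  ... | true  = trans (cong (_+_ v) (trans (sumF-cong others-vanish) (sumF-0 n))) (ℤP.+-identityʳ v)
    where
    others-vanish : ∀ i → (if B (suc i) then v else + 0) ≡ + 0
    others-vanish i with B (suc i) in Bi
    ... | false = refl
    ... | true  with unique zero (suc i) B0 Bi
    ... | ()
  ... | false = trans (ℤP.+-identityˡ _)
                      (sumF-at-most-one (λ i → B (suc i)) v
                        (λ i i' Bi Bi' → FinP.suc-injective (unique (suc i) (suc i') Bi Bi')))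

  bitSum-disjoint-union : ∀ {m n} (J : Fin m → Fin n → Bool) →
                          (∀ j i i' → J i j ≡ true → J i' j ≡ true → i ≡ i') →
                          ∀ c → sumF (λ i → bitSum c (J i)) ≡ bitSum c (λ j → anyF (λ i → J i j))
  bitSum-disjoint-union J disjoint c =
    trans (sumF-comm (λ i j → if J i j then c j else + 0))
          (sumF-cong (λ j → sumF-at-most-one (λ i → J i j) (c j) (disjoint j)))

  bitSum-+ : ∀ {n} (f g : Fin n → ℤ) J → bitSum (λ j → f j + g j) J ≡ bitSum f J + bitSum g J
  bitSum-+ f g J = trans (sumF-cong term) (sumF-+ (λ j → if J j then f j else + 0) (λ j → if J j then g j else + 0))
    where
    term : ∀ j → (if J j then f j + g j else + 0)
                 ≡ (if J j then f j else + 0) + (if J j then g j else + 0)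
    term j with J j
    ... | true  = refl
    ... | false = refl

  bitSum-* : ∀ {n} c (f : Fin n → ℤ) J → c * bitSum f J ≡ bitSum (λ j → c * f j) J
  bitSum-* c f J = trans (sym (sumF-* c (λ j → if J j then f j else + 0))) (sumF-cong term)
    where
    term : ∀ j → c * (if J j then f j else + 0) ≡ (if J j then c * f j else + 0)
    term j with J j
    ... | true  = refl
    ... | false = ℤP.*-zeroʳ c

module Fermat {p : ℕ} (p-prime : Prime p) where
  open import Data.Nat.DivMod using (m/n*n≡m)
  open import Data.Nat.Combinatorics using (_C_; nCn≡1; k![n∸k]!∣n!)
  open import Data.Nat.Combinatorics.Specification using (nCk≡n!/k![n-k]!)
  open import Data.Integer.DivMod using (a≡a%ℕn+[a/ℕn]*n; _%ℕ_; _/ℕ_)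
  open import Data.Fin using (toℕ; inject₁; fromℕ)
  open import Data.Vec.Functional using (init; tail)
  open import Algebra.Properties.CommutativeSemiring.Binomial ℤP.+-*-commutativeSemiring
    using (theorem; binomialTerm)
  open import Algebra.Definitions.RawSemiring ℤ.+-*-rawSemiring using (sum; _^_) renaming (_×_ to _×ℤ_)
  open import Algebra.Properties.Monoid.Sum ℤP.+-0-monoid using (sum-init-last)

  open Congruence p

  1<p : 1 < p
  1<p = ℕ.nonTrivial⇒n>1 p {{prime⇒nonTrivial p-prime}}

  p∤k! : ∀ k → k < p → ¬ (p ℕD.∣ k !)
  p∤k! zero    _   p∣1 = ℕP.<⇒≢ 1<p (sym (ℕD.∣1⇒≡1 p∣1))
  p∤k! (suc k) k<p p∣k! with euclidsLemma (suc k) (k !) p-prime p∣k!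
  ... | inj₁ p∣1+k = ℕP.<⇒≱ k<p (ℕD.∣⇒≤ p∣1+k)
  ... | inj₂ p∣k!  = p∤k! k (ℕP.<-trans (ℕP.n<1+n k) k<p) p∣k!

  -- The inner binomial coefficients (p C k), 0 < k < p, are divisible by p,
  -- since (p C k)·k!·(p-k)! = p! and p divides neither k! nor (p-k)!.
  p∣pCk : ∀ k → 0 < k → k < p → p ℕD.∣ (p C k)
  p∣pCk k 0<k k<p with euclidsLemma (p C k) (k ! ℕ.* (p ℕ.∸ k) !) p-prime p∣p!
    where
    k≤p = ℕP.<⇒≤ k<p
    pCk*k!*[p-k]!≡p! : (p C k) ℕ.* (k ! ℕ.* (p ℕ.∸ k) !) ≡ p !
    pCk*k!*[p-k]!≡p! = trans (cong (ℕ._* (k ! ℕ.* (p ℕ.∸ k) !)) (nCk≡n!/k![n-k]! k≤p))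
                             (m/n*n≡m {{ℕP._!*_!≢0 k (p ℕ.∸ k)}} (k![n∸k]!∣n! k≤p))
    n∣n! : ∀ n → 0 < n → n ℕD.∣ n !
    n∣n! (suc n) _ = ℕD.m∣m*n (n !)
    p∣p! : p ℕD.∣ (p C k) ℕ.* (k ! ℕ.* (p ℕ.∸ k) !)
    p∣p! = subst (p ℕD.∣_) (sym pCk*k!*[p-k]!≡p!) (n∣n! p (ℕP.<-trans 0<k k<p))
  ... | inj₁ p∣pCk = p∣pCk
  ... | inj₂ p∣k!*[p-k]! with euclidsLemma (k !) ((p ℕ.∸ k) !) p-prime p∣k!*[p-k]!
  ... | inj₁ p∣k!     = ⊥-elim (p∤k! k k<p p∣k!)
  ... | inj₂ p∣[p-k]! = ⊥-elim (p∤k! (p ℕ.∸ k) (ℕP.∸-monoʳ-< 0<k (ℕP.<⇒≤ k<p)) p∣[p-k]!)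

  private
    -- The binomial theorem is stated with the library's powers and
    -- multiples; these agree with ^ℤ and with multiplication by + n.
    ^≡^ℤ : ∀ x n → x ^ n ≡ x ^ℤ n
    ^≡^ℤ x zero    = refl
    ^≡^ℤ x (suc n) = cong (x *_) (^≡^ℤ x n)

    ×≡* : ∀ n x → n ×ℤ x ≡ + n * x
    ×≡* zero    x = sym (ℤP.*-zeroˡ x)
    ×≡* (suc n) x = trans (cong (_+_ x) (×≡* n x)) (sym (ℤP.suc-* (+ n) x))

    1^n≡1 : ∀ n → (+ 1) ^ n ≡ + 1
    1^n≡1 zero    = refl
    1^n≡1 (suc n) = trans (ℤP.*-identityˡ _) (1^n≡1 n)

    sum≈0 : ∀ {n} (f : Fin n → ℤ) → (∀ i → f i ≈ + 0) → sum f ≈ + 0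
    sum≈0 {zero}  f f≈0 = ≈-refl
    sum≈0 {suc n} f f≈0 = +-cong (f≈0 zero) (sum≈0 (tail f) (λ i → f≈0 (suc i)))

  -- Freshman's dream: (1 + x)^p ≈ 1 + x^p.  In the binomial expansion all
  -- terms but the first and the last are multiples of p.
  frobenius : ∀ x → (+ 1 + x) ^ℤ p ≈ + 1 + x ^ℤ p
  frobenius x with 1<p
  ... | s≤s {n = m} (s≤s _) = begin
    (+ 1 + x) ^ℤ p                           ≡⟨ sym (^≡^ℤ (+ 1 + x) p) ⟩
    (+ 1 + x) ^ p                            ≡⟨ theorem p (+ 1) x ⟩
    g zero + sum (tail g)                    ≡⟨ cong (_+_ (g zero)) (sum-init-last (tail g)) ⟩
    g zero + (sum middle + g (fromℕ p))      ≈⟨ +-cong (≡⇒≈ first≡x^p) (+-cong middle≈0 (≡⇒≈ last≡1)) ⟩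
    x ^ℤ p + (+ 0 + + 1)                     ≡⟨ ℤP.+-comm (x ^ℤ p) (+ 1) ⟩
    + 1 + x ^ℤ p                             ∎
    where
    open SetoidReasoning ≈-setoid
    g : Fin (suc p) → ℤ
    g = binomialTerm (+ 1) x p
    middle : Fin m → ℤ
    middle = init (tail g)
    first≡x^p : g zero ≡ x ^ℤ p
    first≡x^p = trans (ℤP.+-identityʳ _) (trans (ℤP.*-identityˡ _) (^≡^ℤ x p))
    middle-term≈0 : ∀ i → middle i ≈ + 0
    middle-term≈0 i = subst (_≈ + 0) (sym (×≡* (p C k) y))
                   (∣⇒≈0 (SD.∣m⇒∣m*n y (∣ᵤ⇒∣ {+ p} {+ (p C k)} (p∣pCk k (s≤s z≤n) k<p))))
      where
      k = suc (toℕ (inject₁ i))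
      y = (+ 1) ^ k * x ^ (p ℕ.∸ k)
      k<p : k < p
      k<p = s≤s (subst (ℕ._< m) (sym (FinP.toℕ-inject₁ i)) (FinP.toℕ<n i))
    middle≈0 : sum middle ≈ + 0
    middle≈0 = sum≈0 middle middle-term≈0
    last≡1 : g (fromℕ p) ≡ + 1
    last≡1 = trans (cong term (FinP.toℕ-fromℕ p))
             (trans (cong₂ (λ c e → c ×ℤ ((+ 1) ^ p * x ^ e)) (nCn≡1 p) (ℕP.n∸n≡0 p))
             (trans (ℤP.+-identityʳ _) (trans (ℤP.*-identityʳ _) (1^n≡1 p))))
      where
      term : ℕ → ℤ
      term j = (p C j) ×ℤ ((+ 1) ^ j * x ^ (p ℕ.∸ j))

  -- Fermat's theorem a^p ≈ a: for natural numbers by induction on a using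
  -- the freshman's dream, for arbitrary integers by reduction modulo p.
  fermat-ℕ : ∀ n → (+ n) ^ℤ p ≈ + n
  fermat-ℕ zero with 1<p
  ... | s≤s _ = ≈-refl
  fermat-ℕ (suc n) = ≈-trans (frobenius (+ n)) (+-cong (≈-refl {+ 1}) (fermat-ℕ n))

  private instance
    p≢0 : ℕ.NonZero p
    p≢0 = prime⇒nonZero p-prime

  fermat : ∀ a → a ^ℤ p ≈ a
  fermat a = begin
    a ^ℤ p      ≈⟨ ^-cong p a≈r ⟩
    (+ r) ^ℤ p  ≈⟨ fermat-ℕ r ⟩
    + r         ≈⟨ ≈-sym a≈r ⟩
    a           ∎
    where
    open SetoidReasoning ≈-setoid
    r = a %ℕ p
    a≈r : a ≈ + r
    a≈r = begin
      a                       ≡⟨ a≡a%ℕn+[a/ℕn]*n a p ⟩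
      + r + (a /ℕ p) * + p    ≈⟨ +-cong (≈-refl {+ r}) (*p≈0 (a /ℕ p)) ⟩
      + r + + 0               ≡⟨ ℤP.+-identityʳ (+ r) ⟩
      + r                     ∎

  -- Fermat's little theorem: a^(p-1) ≈ 1 for a ≉ 0, by cancelling a
  -- from a · (a^(p-1) - 1) ≈ a^p - a ≈ 0.
  fermat-little : ∀ a → ¬ (a ≈ + 0) → a ^ℤ (p ℕ.∸ 1) ≈ + 1
  fermat-little a a≉0 with 1<p
  ... | s≤s {n = m} _ with *≈0⇒ p-prime a*[a^m-1]≈0
    where
    open SetoidReasoning ≈-setoid
    a*[a^m-1]≈0 : a * (a ^ℤ m - + 1) ≈ + 0
    a*[a^m-1]≈0 = begin
      a * (a ^ℤ m - + 1)   ≡⟨ ℤP.*-distribˡ-+ a (a ^ℤ m) (- + 1) ⟩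
      a ^ℤ p + a * - + 1   ≈⟨ +-cong (fermat a) (≡⇒≈ (ℤP.*-comm a (- + 1))) ⟩
      a + - + 1 * a        ≡⟨ cong (_+_ a) (ℤP.-1*i≡-i a) ⟩
      a - a                ≡⟨ ℤP.+-inverseʳ a ⟩
      + 0                  ∎
  ... | inj₁ a≈0       = ⊥-elim (a≉0 a≈0)
  ... | inj₂ a^m-1≈0   = x-y≈0⇒x≈y a^m-1≈0

LP : ∀ {d} → (Fin d → ℤ) → Poly d
LP lam = sumP (λ i → scaleP (lam i) (varP i))

SP : ∀ d → Poly d
SP d = sumP (λ i → varP i)

module Evaluation where
  open import Algebra.Properties.CommutativeSemigroup ℤP.*-commutativeSemigroup
    using () renaming (interchange to *-interchange)

  open FiniteSums

  monomial : ∀ {d} → (Fin d → ℤ) → Vec ℕ d → ℤ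
  monomial x e = prodF (λ i → x i ^ℤ lookup e i)

  ^ℤ-+ : ∀ a m n → a ^ℤ (m ℕ.+ n) ≡ a ^ℤ m * a ^ℤ n
  ^ℤ-+ a zero    n = sym (ℤP.*-identityˡ _)
  ^ℤ-+ a (suc m) n = trans (cong (a *_) (^ℤ-+ a m n)) (sym (ℤP.*-assoc a _ _))

  monomial-+ : ∀ {d} (x : Fin d → ℤ) e e' →
               monomial x (zipWith ℕ._+_ e e') ≡ monomial x e * monomial x e'
  monomial-+ x []      []        = refl
  monomial-+ x (m ∷ e) (n ∷ e') =
    trans (cong₂ _*_ (^ℤ-+ (x zero) m n) (monomial-+ (λ i → x (suc i)) e e'))
          (*-interchange (x zero ^ℤ m) (x zero ^ℤ n) _ _)

  monomial-1 : ∀ {d} (x : Fin d → ℤ) → monomial x (replicate d 0) ≡ + 1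
  monomial-1 {zero}  x = refl
  monomial-1 {suc d} x = trans (ℤP.*-identityˡ _) (monomial-1 (λ i → x (suc i)))

  monomial-var : ∀ {d} (x : Fin d → ℤ) i → monomial x (unitVec i) ≡ x i
  monomial-var {suc d} x zero =
    trans (cong (λ m → x zero * + 1 * m) (monomial-1 (λ i → x (suc i))))
          (trans (ℤP.*-identityʳ _) (ℤP.*-identityʳ _))
  monomial-var {suc d} x (suc i) = trans (ℤP.*-identityˡ _) (monomial-var (λ i → x (suc i)) i)

  evalP-++ : ∀ {d} (x : Fin d → ℤ) P Q → evalP x (P ++ Q) ≡ evalP x P + evalP x Q
  evalP-++ x []            Q = sym (ℤP.+-identityˡ _)
  evalP-++ x ((c , e) ∷ P) Q =
    trans (cong (_+_ (c * monomial x e)) (evalP-++ x P Q))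
          (sym (ℤP.+-assoc (c * monomial x e) (evalP x P) (evalP x Q)))

  termValue : ∀ {d} → (Fin d → ℤ) → ℤ × Vec ℕ d → ℤ
  termValue x (c , e) = c * monomial x e

  evalP-map : ∀ {d} (x : Fin d → ℤ) (g : ℤ × Vec ℕ d → ℤ × Vec ℕ d) k →
              (∀ t → termValue x (g t) ≡ k * termValue x t) →
              ∀ Q → evalP x (map g Q) ≡ k * evalP x Q
  evalP-map x g k g-scales []      = sym (ℤP.*-zeroʳ k)
  evalP-map x g k g-scales (t ∷ Q) =
    trans (cong₂ _+_ (g-scales t) (evalP-map x g k g-scales Q)) (sym (ℤP.*-distribˡ-+ k _ _))

  evalP-scale : ∀ {d} (x : Fin d → ℤ) k P → evalP x (scaleP k P) ≡ k * evalP x P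
  evalP-scale x k = evalP-map x _ k (λ (c , e) → ℤP.*-assoc k c (monomial x e))

  evalP-* : ∀ {d} (x : Fin d → ℤ) P Q → evalP x (P *P Q) ≡ evalP x P * evalP x Q
  evalP-* x []            Q = refl
  evalP-* x ((c , e) ∷ P) Q =
    trans (evalP-++ x (map _ Q) (P *P Q))
    (trans (cong₂ _+_ (evalP-map x _ (c * monomial x e) term-product Q) (evalP-* x P Q))
           (sym (ℤP.*-distribʳ-+ (evalP x Q) (c * monomial x e) (evalP x P))))
    where
    term-product : ∀ ((c' , e') : ℤ × Vec ℕ _) →
                   c * c' * monomial x (zipWith ℕ._+_ e e') ≡ c * monomial x e * (c' * monomial x e')
    term-product (c' , e') = trans (cong (c * c' *_) (monomial-+ x e e')) (*-interchange c c' _ _)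

  evalP-const : ∀ {d} (x : Fin d → ℤ) c → evalP x (constP c) ≡ c
  evalP-const x c = trans (ℤP.+-identityʳ _) (trans (cong (c *_) (monomial-1 x)) (ℤP.*-identityʳ c))

  evalP-var : ∀ {d} (x : Fin d → ℤ) i → evalP x (varP i) ≡ x i
  evalP-var x i = trans (ℤP.+-identityʳ _) (trans (ℤP.*-identityˡ _) (monomial-var x i))

  evalP-^ : ∀ {d} (x : Fin d → ℤ) P n → evalP x (P ^P n) ≡ evalP x P ^ℤ n
  evalP-^ x P zero    = evalP-const x (+ 1)
  evalP-^ x P (suc n) = trans (evalP-* x P (P ^P n)) (cong (evalP x P *_) (evalP-^ x P n))

  evalP-sumP : ∀ {d n} (x : Fin d → ℤ) (f : Fin n → Poly d) →
               evalP x (sumP f) ≡ sumF (λ i → evalP x (f i))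
  evalP-sumP {n = zero}  x f = refl
  evalP-sumP {n = suc n} x f =
    trans (evalP-++ x (f zero) _) (cong (_+_ (evalP x (f zero))) (evalP-sumP x (λ i → f (suc i))))

  evalP-- : ∀ {d} (x : Fin d → ℤ) P Q → evalP x (P -P Q) ≡ evalP x P - evalP x Q
  evalP-- x P Q = trans (evalP-++ x P _)
    (cong (_+_ (evalP x P)) (trans (evalP-scale x (- + 1) Q) (ℤP.-1*i≡-i _)))

  evalQ : ∀ p {d} (lam : Fin d → ℤ) χ (x : Fin d → ℤ) →
          evalP x (Qpoly p lam χ) ≡
            (sumF (λ i → lam i * x i) * (sumF (λ i → lam i * x i) - χ))
              * (sumF x ^ℤ (p ℕ.∸ 1) - + 1)
  evalQ p {d} lam χ x = begin
    evalP x ((L *P (L -P constP χ)) *P ((S ^P (p ℕ.∸ 1)) -P constP (+ 1)))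
      ≡⟨ evalP-* x (L *P (L -P constP χ)) _ ⟩
    evalP x (L *P (L -P constP χ)) * evalP x ((S ^P (p ℕ.∸ 1)) -P constP (+ 1))
      ≡⟨ cong₂ _*_ (evalP-* x L _) (evalP-- x (S ^P (p ℕ.∸ 1)) _) ⟩
    evalP x L * evalP x (L -P constP χ) * (evalP x (S ^P (p ℕ.∸ 1)) - evalP x (constP (+ 1)))
      ≡⟨ cong₂ (λ u v → evalP x L * u * v) (evalP-- x L _) (cong₂ _-_ (evalP-^ x S (p ℕ.∸ 1)) (evalP-const x (+ 1))) ⟩
    evalP x L * (evalP x L - evalP x (constP χ)) * (evalP x S ^ℤ (p ℕ.∸ 1) - + 1)
      ≡⟨ cong₂ (λ l s → l * (l - evalP x (constP χ)) * (s ^ℤ (p ℕ.∸ 1) - + 1)) L-at-x S-at-x ⟩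
    sumF (λ i → lam i * x i) * (sumF (λ i → lam i * x i) - evalP x (constP χ)) * (sumF x ^ℤ (p ℕ.∸ 1) - + 1)
      ≡⟨ cong (λ c → sumF (λ i → lam i * x i) * (sumF (λ i → lam i * x i) - c) * (sumF x ^ℤ (p ℕ.∸ 1) - + 1))
              (evalP-const x χ) ⟩
    sumF (λ i → lam i * x i) * (sumF (λ i → lam i * x i) - χ) * (sumF x ^ℤ (p ℕ.∸ 1) - + 1)
      ∎
    where
    open ≡-Reasoning
    L = LP lam
    S = SP d
    L-at-x : evalP x L ≡ sumF (λ i → lam i * x i)
    L-at-x = trans (evalP-sumP x (λ i → scaleP (lam i) (varP i))) (sumF-cong (λ i → trans (evalP-scale x (lam i) (varP i))
                                                           (cong (lam i *_) (evalP-var x i))))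
    S-at-x : evalP x S ≡ sumF x
    S-at-x = trans (evalP-sumP x varP) (sumF-cong (evalP-var x))

module Vanishing {p : ℕ} (p-prime : Prime p) {ℓ d : ℕ} (a b : Fin ℓ → ℤ)
  (a≢0 : ∀ j → ¬ (a j ≡[ p ] + 0))
  (𝒮A⊆𝒮B : ∀ (x : Fin ℓ → Bool) → InS p a x → InS p b x)
  (lam : Fin d → ℤ) (ratios : IsRatios p a b lam)
  (i0 j0 : Fin d) (k : Fin ℓ) (k∈I₀ : Iλ p a b (lam i0) k) where

  open Congruence p
  open Fermat p-prime using (fermat-little)
  open FiniteSums
  open Evaluation using (evalQ)

  χ : ℤ
  χ = (lam j0 - lam i0) * a k

  I′ : Fin d → Fin ℓ → Set
  I′ = I' p a b lam i0 j0 k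

  ratio : ∀ {μ j} → Iλ p a b μ j → b j ≈ μ * a j
  ratio {μ} {j} = ≡[p]⇒≈ {b j} {μ * a j}

  ratio-unique : ∀ {μ ν j} → Iλ p a b μ j → Iλ p a b ν j → μ ≈ ν
  ratio-unique {μ} {ν} {j} j∈Iμ j∈Iν = cancel-a (*≈0⇒ p-prime {μ - ν} {a j} [μ-ν]a≈0)
    where
    open SetoidReasoning ≈-setoid
    [μ-ν]a≈0 : (μ - ν) * a j ≈ + 0
    [μ-ν]a≈0 = begin
      (μ - ν) * a j       ≡⟨ ℤP.*-distribʳ-+ (a j) μ (- ν) ⟩
      μ * a j + - ν * a j ≡⟨ cong (_+_ (μ * a j)) (sym (ℤP.neg-distribˡ-* ν (a j))) ⟩
      μ * a j - ν * a j   ≈⟨ -cong (≈-sym (ratio {μ} j∈Iμ)) (≈-sym (ratio {ν} j∈Iν)) ⟩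
      b j - b j           ≡⟨ ℤP.+-inverseʳ (b j) ⟩
      + 0                 ∎
    cancel-a : μ - ν ≈ + 0 ⊎ a j ≈ + 0 → μ ≈ ν
    cancel-a (inj₁ μ-ν≈0) = x-y≈0⇒x≈y μ-ν≈0
    cancel-a (inj₂ aj≈0)  = ⊥-elim (a≢0 j (≈⇒≡[p] {a j} aj≈0))

  lam-injective : ∀ i i' → lam i ≈ lam i' → i ≡ i'
  lam-injective i i' λi≈λi' with i ≟ i'
  ... | yes i≡i' = i≡i'
  ... | no  i≢i' = ⊥-elim (proj₁ ratios i i' i≢i' (≈⇒≡[p] λi≈λi'))

  I′-cases : ∀ i j → I′ i j → (j ≡ k × i ≡ j0) ⊎ (j ≢ k × Iλ p a b (lam i) j)
  I′-cases i j j∈I′ with i ≟ i0 | i ≟ j0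
  ... | yes _ | _ = inj₂ (proj₂ j∈I′ , proj₁ j∈I′)
  ... | no _ | yes i≡j0 with j∈I′
  ...   | inj₂ j≡k = inj₁ (j≡k , i≡j0)
  ...   | inj₁ j∈I with j ≟ k
  ...     | yes j≡k = inj₁ (j≡k , i≡j0)
  ...     | no  j≢k = inj₂ (j≢k , j∈I)
  I′-cases i j j∈I′ | no i≢i0 | no _ with j ≟ k
  ... | yes refl = ⊥-elim (i≢i0 (lam-injective i i0 (ratio-unique {lam i} {lam i0} j∈I′ k∈I₀)))
  ... | no  j≢k  = inj₂ (j≢k , j∈I′)

  I′-disjoint : ∀ j i i' → I′ i j → I′ i' j → i ≡ i'
  I′-disjoint j i i' j∈I′ j∈I′' with I′-cases i j j∈I′ | I′-cases i' j j∈I′'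
  ... | inj₁ (_ , i≡j0)  | inj₁ (_ , i'≡j0)  = trans i≡j0 (sym i'≡j0)
  ... | inj₁ (j≡k , _)   | inj₂ (j≢k , _)    = ⊥-elim (j≢k j≡k)
  ... | inj₂ (j≢k , _)   | inj₁ (j≡k , _)    = ⊥-elim (j≢k j≡k)
  ... | inj₂ (_ , j∈I)   | inj₂ (_ , j∈I')   =
    lam-injective i i' (ratio-unique {lam i} {lam i'} j∈I j∈I')

  -- The defect of the relation b_j = λ_i a_j on I′ i: it is zero except at
  -- the moved index k, where it is (λ_i − λ_{i0}) a_k.
  defect : Fin d → Fin ℓ → ℤ
  defect i j with j ≟ k
  ... | yes _ = (lam i - lam i0) * a k
  ... | no  _ = + 0

  I′-ratio : ∀ i j → I′ i j → lam i * a j ≈ b j + defect i j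
  I′-ratio i j j∈I′ with j ≟ k
  ... | yes refl = ≈-sym (begin
    b k + (lam i - lam i0) * a k          ≈⟨ +-cong (ratio {lam i0} k∈I₀) (≈-refl {(lam i - lam i0) * a k}) ⟩
    lam i0 * a k + (lam i - lam i0) * a k ≡⟨ shift (lam i) (lam i0) (a k) ⟩
    lam i * a k                            ∎)
    where
    open SetoidReasoning ≈-setoid
    shift : ∀ μ μ₀ r → μ₀ * r + (μ - μ₀) * r ≡ μ * r
    shift = solve-∀
  ... | no j≢k with I′-cases i j j∈I′
  ...   | inj₁ (j≡k , _) = ⊥-elim (j≢k j≡k)
  ...   | inj₂ (_ , j∈I) = ≈-sym (≈-trans (≡⇒≈ (ℤP.+-identityʳ (b j))) (ratio {lam i} j∈I))

  defect-off : ∀ i j → j ≢ k → defect i j ≡ + 0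
  defect-off i j j≢k with j ≟ k
  ... | yes j≡k = ⊥-elim (j≢k j≡k)
  ... | no  _   = refl

  defect-at-k : ∀ i → defect i k ≡ (lam i - lam i0) * a k
  defect-at-k i with k ≟ k
  ... | yes _   = refl
  ... | no  k≢k = ⊥-elim (k≢k refl)

  module AtPoint (x : Fin d → ℤ) (x∈Σ′ : ∀ i → InSubsetSums p a (I′ i) (x i)) where

    J : Fin d → Fin ℓ → Bool
    J i = proj₁ (x∈Σ′ i)

    J⊆I′ : ∀ i j → J i j ≡ true → I′ i j
    J⊆I′ i = proj₁ (proj₂ (x∈Σ′ i))

    x≈ : ∀ i → x i ≈ bitSum a (J i)
    x≈ i = ≡[p]⇒≈ {x i} (proj₂ (proj₂ (x∈Σ′ i)))

    J-disjoint : ∀ j i i' → J i j ≡ true → J i' j ≡ true → i ≡ i'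
    J-disjoint j i i' j∈Ji j∈Ji' = I′-disjoint j i i' (J⊆I′ i j j∈Ji) (J⊆I′ i' j j∈Ji')

    J∪ : Fin ℓ → Bool
    J∪ j = anyF (λ i → J i j)

    Σx≈ : sumF x ≈ bitSum a J∪
    Σx≈ = ≈-trans (sumF-cong-≈ x≈) (≡⇒≈ (bitSum-disjoint-union J J-disjoint a))

    -- Only the moved index k, and only inside J j0, contributes a defect.
    D : ℤ
    D = if J j0 k then χ else + 0

    total-defect : sumF (λ i → bitSum (defect i) (J i)) ≡ D
    total-defect = begin
      sumF (λ i → bitSum (defect i) (J i))                ≡⟨ sumF-cong row ⟩
      sumF (λ i → if J i k then defect i k else + 0)      ≡⟨ sumF-single _ j0 column ⟩
      (if J j0 k then defect j0 k else + 0)               ≡⟨ cong (λ c → if J j0 k then c else + 0) (defect-at-k j0) ⟩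
      D                                                   ∎
      where
      open ≡-Reasoning
      row : ∀ i → bitSum (defect i) (J i) ≡ (if J i k then defect i k else + 0)
      row i = sumF-single _ k off-k
        where
        off-k : ∀ j → j ≢ k → (if J i j then defect i j else + 0) ≡ + 0
        off-k j j≢k with J i j
        ... | true  = defect-off i j j≢k
        ... | false = refl
      column : ∀ i → i ≢ j0 → (if J i k then defect i k else + 0) ≡ + 0
      column i i≢j0 with J i k in k∈Ji
      ... | false = refl
      ... | true with I′-cases i k (J⊆I′ i k k∈Ji)
      ...   | inj₁ (_ , i≡j0) = ⊥-elim (i≢j0 i≡j0)
      ...   | inj₂ (k≢k , _)  = ⊥-elim (k≢k refl)

    Σλx≈ : sumF (λ i → lam i * x i) ≈ bitSum b J∪ + D
    Σλx≈ = begin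
      sumF (λ i → lam i * x i)
        ≈⟨ sumF-cong-≈ (λ i → *-cong (≈-refl {lam i}) (x≈ i)) ⟩
      sumF (λ i → lam i * bitSum a (J i))
        ≡⟨ sumF-cong (λ i → bitSum-* (lam i) a (J i)) ⟩
      sumF (λ i → bitSum (λ j → lam i * a j) (J i))
        ≈⟨ sumF-cong-≈ (λ i → bitSum-cong-≈ (J i) (λ j j∈Ji → I′-ratio i j (J⊆I′ i j j∈Ji))) ⟩
      sumF (λ i → bitSum (λ j → b j + defect i j) (J i))
        ≡⟨ sumF-cong (λ i → bitSum-+ b (defect i) (J i)) ⟩
      sumF (λ i → bitSum b (J i) + bitSum (defect i) (J i))
        ≡⟨ sumF-+ (λ i → bitSum b (J i)) (λ i → bitSum (defect i) (J i)) ⟩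
      sumF (λ i → bitSum b (J i)) + sumF (λ i → bitSum (defect i) (J i))
        ≡⟨ cong₂ _+_ (bitSum-disjoint-union J J-disjoint b) total-defect ⟩
      bitSum b J∪ + D
        ∎
      where open SetoidReasoning ≈-setoid

    -- If Σ x_i = 0 then J∪ ∈ 𝒮_A ⊆ 𝒮_B, so Σ λ_i x_i = D ∈ {0, χ}.
    J∪∈𝒮B : sumF x ≈ + 0 → bitSum b J∪ ≈ + 0
    J∪∈𝒮B Σx≈0 = ≡[p]⇒≈ {bitSum b J∪} (𝒮A⊆𝒮B J∪ (≈⇒≡[p] {bitSum a J∪} (≈-trans (≈-sym Σx≈) Σx≈0)))

    D≡0-or-χ : D ≡ + 0 ⊎ D ≡ χ
    D≡0-or-χ = by-membership (J j0 k)
      where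
      by-membership : ∀ m → (if m then χ else + 0) ≡ + 0 ⊎ (if m then χ else + 0) ≡ χ
      by-membership false = inj₁ refl
      by-membership true  = inj₂ refl

    Σλx≈0-or-χ : sumF x ≈ + 0 → sumF (λ i → lam i * x i) ≈ + 0 ⊎ sumF (λ i → lam i * x i) ≈ χ
    Σλx≈0-or-χ Σx≈0 = transport D≡0-or-χ
      where
      Σλx≈D : sumF (λ i → lam i * x i) ≈ D
      Σλx≈D = ≈-trans Σλx≈ (≈-trans (+-cong (J∪∈𝒮B Σx≈0) (≈-refl {D})) (≡⇒≈ (ℤP.+-identityˡ D)))
      transport : D ≡ + 0 ⊎ D ≡ χ → sumF (λ i → lam i * x i) ≈ + 0 ⊎ sumF (λ i → lam i * x i) ≈ χ
      transport (inj₁ D≡0) = inj₁ (≈-trans Σλx≈D (≡⇒≈ D≡0))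
      transport (inj₂ D≡χ) = inj₂ (≈-trans Σλx≈D (≡⇒≈ D≡χ))

  -- Part one: Q vanishes on ∏ Σ'_i.  Either Σ x_i = 0, and then the first
  -- two factors vanish, or Σ x_i ≠ 0 and Fermat kills the last factor.
  Q-vanishes : ∀ x → (∀ i → InSubsetSums p a (I′ i) (x i)) → evalP x (Qpoly p lam χ) ≡[ p ] + 0
  Q-vanishes x x∈Σ′ =
    ≈⇒≡[p] (≈-trans (≡⇒≈ (evalQ p lam χ x)) (root-product Σλx χ _ factor-vanishes))
    where
    open AtPoint x x∈Σ′
    Σλx = sumF (λ i → lam i * x i)
    factor-vanishes : (Σλx ≈ + 0 ⊎ Σλx ≈ χ) ⊎ sumF x ^ℤ (p ℕ.∸ 1) - + 1 ≈ + 0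
    factor-vanishes with sumF x ≈? + 0
    ... | yes Σx≈0 = inj₁ (Σλx≈0-or-χ Σx≈0)
    ... | no  Σx≉0 = inj₂ (x≈y⇒x-y≈0 (fermat-little (sumF x) Σx≉0))

module TermSums where
  open import Algebra.Properties.CommutativeSemigroup ℤP.+-commutativeSemigroup
    using () renaming (interchange to +-interchange)

  Term : ℕ → Set
  Term d = ℤ × Vec ℕ d

  sumTerms : ∀ {d} → (Term d → ℤ) → Poly d → ℤ
  sumTerms f []      = + 0
  sumTerms f (u ∷ P) = f u + sumTerms f P

  _·_ : ∀ {d} → Term d → Term d → Term d
  (c , e) · (c' , e') = (c * c' , zipWith ℕ._+_ e e')

  sumTerms-cong : ∀ {d} {f g : Term d → ℤ} → (∀ u → f u ≡ g u) → ∀ P → sumTerms f P ≡ sumTerms g P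
  sumTerms-cong f≡g []      = refl
  sumTerms-cong f≡g (u ∷ P) = cong₂ _+_ (f≡g u) (sumTerms-cong f≡g P)

  sumTerms-++ : ∀ {d} (f : Term d → ℤ) P Q → sumTerms f (P ++ Q) ≡ sumTerms f P + sumTerms f Q
  sumTerms-++ f []      Q = sym (ℤP.+-identityˡ _)
  sumTerms-++ f (u ∷ P) Q =
    trans (cong (_+_ (f u)) (sumTerms-++ f P Q)) (sym (ℤP.+-assoc (f u) (sumTerms f P) (sumTerms f Q)))

  sumTerms-map : ∀ {d} (f : Term d → ℤ) (g : Term d → Term d) P →
                 sumTerms f (map g P) ≡ sumTerms (λ u → f (g u)) P
  sumTerms-map f g []      = refl
  sumTerms-map f g (u ∷ P) = cong (_+_ (f (g u))) (sumTerms-map f g P)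

  sumTerms-+ : ∀ {d} (f g : Term d → ℤ) P → sumTerms (λ u → f u + g u) P ≡ sumTerms f P + sumTerms g P
  sumTerms-+ f g []      = refl
  sumTerms-+ f g (u ∷ P) =
    trans (cong (_+_ (f u + g u)) (sumTerms-+ f g P)) (+-interchange (f u) (g u) _ _)

  sumTerms-* : ∀ {d} k (f : Term d → ℤ) P → sumTerms (λ u → k * f u) P ≡ k * sumTerms f P
  sumTerms-* k f []      = sym (ℤP.*-zeroʳ k)
  sumTerms-* k f (u ∷ P) =
    trans (cong (_+_ (k * f u)) (sumTerms-* k f P)) (sym (ℤP.*-distribˡ-+ k (f u) (sumTerms f P)))

  sumTerms-*ʳ : ∀ {d} k (f : Term d → ℤ) P → sumTerms (λ u → f u * k) P ≡ sumTerms f P * k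
  sumTerms-*ʳ k f P = trans (sumTerms-cong (λ u → ℤP.*-comm (f u) k) P)
                            (trans (sumTerms-* k f P) (ℤP.*-comm k (sumTerms f P)))

  sumTerms-sumP : ∀ {d n} (f : Term d → ℤ) (g : Fin n → Poly d) →
                  sumTerms f (sumP g) ≡ sumF (λ i → sumTerms f (g i))
  sumTerms-sumP {n = zero}  f g = refl
  sumTerms-sumP {n = suc n} f g =
    trans (sumTerms-++ f (g zero) _) (cong (_+_ (sumTerms f (g zero))) (sumTerms-sumP f (λ i → g (suc i))))

  sumTerms-*P : ∀ {d} (f : Term d → ℤ) P Q →
                sumTerms f (P *P Q) ≡ sumTerms (λ u → sumTerms (λ v → f (u · v)) Q) P
  sumTerms-*P f []            Q = refl
  sumTerms-*P f ((c , e) ∷ P) Q =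
    trans (sumTerms-++ f (map _ Q) (P *P Q)) (cong₂ _+_ (sumTerms-map f _ Q) (sumTerms-*P f P Q))

  ·-assoc : ∀ {d} (u v w : Term d) → (u · v) · w ≡ u · (v · w)
  ·-assoc (c , e) (c' , e') (c'' , e'') =
    cong₂ _,_ (ℤP.*-assoc c c' c'') (VecP.zipWith-assoc ℕP.+-assoc e e' e'')

  sumTerms-*P-assoc : ∀ {d} (f : Term d → ℤ) P Q R →
                      sumTerms f ((P *P Q) *P R) ≡ sumTerms f (P *P (Q *P R))
  sumTerms-*P-assoc f P Q R = begin
    sumTerms f ((P *P Q) *P R)
      ≡⟨ sumTerms-*P f (P *P Q) R ⟩
    sumTerms (λ w → sumTerms (λ r → f (w · r)) R) (P *P Q)
      ≡⟨ sumTerms-*P _ P Q ⟩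
    sumTerms (λ u → sumTerms (λ v → sumTerms (λ r → f ((u · v) · r)) R) Q) P
      ≡⟨ sumTerms-cong (λ u → sumTerms-cong (λ v → sumTerms-cong (λ r → cong f (·-assoc u v r)) R) Q) P ⟩
    sumTerms (λ u → sumTerms (λ v → sumTerms (λ r → f (u · (v · r))) R) Q) P
      ≡⟨ sumTerms-cong (λ u → sym (sumTerms-*P (λ w → f (u · w)) Q R)) P ⟩
    sumTerms (λ u → sumTerms (λ w → f (u · w)) (Q *P R)) P
      ≡⟨ sym (sumTerms-*P f P (Q *P R)) ⟩
    sumTerms f (P *P (Q *P R))
      ∎
    where open ≡-Reasoning

  sumTerms-*P-1 : ∀ {d} (f : Term d → ℤ) P → sumTerms f (P *P constP (+ 1)) ≡ sumTerms f P
  sumTerms-*P-1 f P = trans (sumTerms-*P f P (constP (+ 1)))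
    (sumTerms-cong (λ (c , e) → trans (ℤP.+-identityʳ _)
                                      (cong f (cong₂ _,_ (ℤP.*-identityʳ c) (VecP.zipWith-identityʳ ℕP.+-identityʳ e)))) P)

  sumTerms-*P-++ : ∀ {d} (f : Term d → ℤ) P A B →
                   sumTerms f (P *P (A ++ B)) ≡ sumTerms f (P *P A) + sumTerms f (P *P B)
  sumTerms-*P-++ f P A B = begin
    sumTerms f (P *P (A ++ B))
      ≡⟨ sumTerms-*P f P (A ++ B) ⟩
    sumTerms (λ u → sumTerms (λ v → f (u · v)) (A ++ B)) P
      ≡⟨ sumTerms-cong (λ u → sumTerms-++ (λ v → f (u · v)) A B) P ⟩
    sumTerms (λ u → sumTerms (λ v → f (u · v)) A + sumTerms (λ v → f (u · v)) B) P
      ≡⟨ sumTerms-+ _ _ P ⟩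
    sumTerms (λ u → sumTerms (λ v → f (u · v)) A) P + sumTerms (λ u → sumTerms (λ v → f (u · v)) B) P
      ≡⟨ sym (cong₂ _+_ (sumTerms-*P f P A) (sumTerms-*P f P B)) ⟩
    sumTerms f (P *P A) + sumTerms f (P *P B)
      ∎
    where open ≡-Reasoning

  CoefficientLinear : ∀ {d} → (Term d → ℤ) → Set
  CoefficientLinear f = ∀ k c e → f (k * c , e) ≡ k * f (c , e)

  sumTerms-*P-scale : ∀ {d} (f : Term d → ℤ) → CoefficientLinear f → ∀ k P Q →
                      sumTerms f (P *P scaleP k Q) ≡ k * sumTerms f (P *P Q)
  sumTerms-*P-scale f linear k P Q = begin
    sumTerms f (P *P scaleP k Q)
      ≡⟨ sumTerms-*P f P (scaleP k Q) ⟩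
    sumTerms (λ u → sumTerms (λ v → f (u · v)) (scaleP k Q)) P
      ≡⟨ sumTerms-cong (λ u → trans (sumTerms-map _ _ Q) (sumTerms-cong (pull-out u) Q)) P ⟩
    sumTerms (λ u → sumTerms (λ v → k * f (u · v)) Q) P
      ≡⟨ sumTerms-cong (λ u → sumTerms-* k _ Q) P ⟩
    sumTerms (λ u → k * sumTerms (λ v → f (u · v)) Q) P
      ≡⟨ sumTerms-* k _ P ⟩
    k * sumTerms (λ u → sumTerms (λ v → f (u · v)) Q) P
      ≡⟨ cong (k *_) (sym (sumTerms-*P f P Q)) ⟩
    k * sumTerms f (P *P Q)
      ∎
    where
    open ≡-Reasoning
    pull-out : ∀ u v → f (u · (k * proj₁ v , proj₂ v)) ≡ k * f (u · v)
    pull-out (c , e) (c' , e') =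
      trans (cong (λ z → f (z , zipWith ℕ._+_ e e')) (*-left-comm c k c')) (linear k (c * c') (zipWith ℕ._+_ e e'))
      where
      *-left-comm : ∀ c k c' → c * (k * c') ≡ k * (c * c')
      *-left-comm = solve-∀

-- For an exponent vector t
-- and a degree m, Φ m t sends c·X^e to c · (t)_e · [|e| = m], where
-- (t)_e = ∏ t_i (t_i − 1) ⋯ (t_i − e_i + 1) is a falling factorial.  For
-- m = |t| this extracts t! times the coefficient of X^t, and multiplying by
-- S = Σ X_i only rescales Φ, so Φ can be evaluated on products of S^(p−1).
module CoefficientFunctional where
  open import Data.List.Relation.Unary.All using (All; []; _∷_)
  import Data.List.Relation.Unary.All.Properties as AllP
  open import Relation.Binary.Definitions using (tri<; tri≈; tri>)
  open import Algebra.Properties.CommutativeSemigroup ℕP.+-commutativeSemigroup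
    using () renaming (interchange to ℕ+-interchange)
  open TermSums
  open FiniteSums

  falling : ℕ → ℕ → ℤ
  falling t       zero    = + 1
  falling zero    (suc e) = + 0
  falling (suc t) (suc e) = + suc t * falling t e

  fallingV : ∀ {d} → Vec ℕ d → Vec ℕ d → ℤ
  fallingV []       []       = + 1
  fallingV (t ∷ ts) (e ∷ es) = falling t e * fallingV ts es

  δ : ℕ → ℕ → ℤ
  δ n m = if n ℕ.≡ᵇ m then + 1 else + 0

  Φ : ∀ {d} → ℕ → Vec ℕ d → Term d → ℤ
  Φ m t (c , e) = c * fallingV t e * δ (sumℕ e) m

  factorials : ∀ {d} → Vec ℕ d → ℤ
  factorials t = prodF (λ i → + fact (lookup t i))

  δ-refl : ∀ n → δ n n ≡ + 1
  δ-refl zero    = refl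
  δ-refl (suc n) = δ-refl n

  δ-≢ : ∀ n m → n ≢ m → δ n m ≡ + 0
  δ-≢ zero    zero    n≢m = ⊥-elim (n≢m refl)
  δ-≢ zero    (suc m) n≢m = refl
  δ-≢ (suc n) zero    n≢m = refl
  δ-≢ (suc n) (suc m) n≢m = δ-≢ n m (λ n≡m → n≢m (cong suc n≡m))

  Φ-linear : ∀ {d} m (t : Vec ℕ d) → CoefficientLinear (Φ m t)
  Φ-linear m t k c e = trans (cong (_* δ (sumℕ e) m) (ℤP.*-assoc k c _)) (ℤP.*-assoc k _ _)

  falling-same : ∀ n → falling n n ≡ + fact n
  falling-same zero    = refl
  falling-same (suc n) = trans (cong (+ suc n *_) (falling-same n)) (sym (ℤP.pos-* (suc n) (fact n)))

  falling-beyond : ∀ t e → t < e → falling t e ≡ + 0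
  falling-beyond zero    (suc e) _          = refl
  falling-beyond (suc t) (suc e) (s≤s t<e) = trans (cong (+ suc t *_) (falling-beyond t e t<e)) (ℤP.*-zeroʳ (+ suc t))

  fallingV-same : ∀ {d} (t : Vec ℕ d) → fallingV t t ≡ factorials t
  fallingV-same []      = refl
  fallingV-same (n ∷ t) = cong₂ _*_ (falling-same n) (fallingV-same t)

  -- (t)_e vanishes unless e ≤ t componentwise; in particular when |t| < |e| ...
  fallingV-beyond : ∀ {d} (t e : Vec ℕ d) → sumℕ t < sumℕ e → fallingV t e ≡ + 0
  fallingV-beyond (t₀ ∷ t) (e₀ ∷ e) |t|<|e| with t₀ ℕP.<? e₀
  ... | yes t₀<e₀ = cong (_* fallingV t e) (falling-beyond t₀ e₀ t₀<e₀)
  ... | no  t₀≮e₀ = trans (cong (falling t₀ e₀ *_) (fallingV-beyond t e rest)) (ℤP.*-zeroʳ (falling t₀ e₀))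
    where
    rest : sumℕ t < sumℕ e
    rest = ℕP.+-cancelˡ-< t₀ (sumℕ t) (sumℕ e)
             (ℕP.<-≤-trans |t|<|e| (ℕP.+-monoˡ-≤ (sumℕ e) (ℕP.≮⇒≥ t₀≮e₀)))

  fallingV-other : ∀ {d} (t e : Vec ℕ d) → sumℕ e ≡ sumℕ t → e ≢ t → fallingV t e ≡ + 0
  fallingV-other []       []       _ e≢t = ⊥-elim (e≢t refl)
  fallingV-other (t₀ ∷ t) (e₀ ∷ e) |e|≡|t| e≢t with ℕP.<-cmp t₀ e₀
  ... | tri< t₀<e₀ _ _ = cong (_* fallingV t e) (falling-beyond t₀ e₀ t₀<e₀)
  ... | tri> _ _ t₀>e₀ = trans (cong (falling t₀ e₀ *_) (fallingV-beyond t e rest)) (ℤP.*-zeroʳ (falling t₀ e₀))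
    where
    rest : sumℕ t < sumℕ e
    rest = ℕP.+-cancelˡ-< e₀ (sumℕ t) (sumℕ e)
             (ℕP.<-≤-trans (ℕP.+-monoˡ-< (sumℕ t) t₀>e₀) (ℕP.≤-reflexive (sym |e|≡|t|)))
  ... | tri≈ _ refl _ =
    trans (cong (falling t₀ e₀ *_)
                (fallingV-other t e (ℕP.+-cancelˡ-≡ t₀ (sumℕ e) (sumℕ t) |e|≡|t|) (λ e≡t → e≢t (cong (t₀ ∷_) e≡t))))
          (ℤP.*-zeroʳ (falling t₀ e₀))

  coeff-via-Φ : ∀ {d} (t : Vec ℕ d) P → coeff t P * factorials t ≡ sumTerms (Φ (sumℕ t) t) P
  coeff-via-Φ t []            = refl
  coeff-via-Φ t ((c , e) ∷ P) with VecP.≡-dec ℕ._≟_ e t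
  ... | yes refl = trans (ℤP.*-distribʳ-+ (factorials t) c (coeff t P)) (cong₂ _+_ Φ-at-t (coeff-via-Φ t P))
    where
    Φ-at-t : c * factorials t ≡ c * fallingV t t * δ (sumℕ t) (sumℕ t)
    Φ-at-t = sym (trans (cong₂ (λ f i → c * f * i) (fallingV-same t) (δ-refl (sumℕ t))) (ℤP.*-identityʳ _))
  ... | no e≢t = trans (coeff-via-Φ t P) (sym (trans (cong (_+ sumTerms (Φ (sumℕ t) t) P) Φ-off-t) (ℤP.+-identityˡ _)))
    where
    Φ-off-t : Φ (sumℕ t) t (c , e) ≡ + 0
    Φ-off-t with sumℕ e ℕ.≟ sumℕ t
    ... | yes |e|≡|t| = trans (cong (λ f → c * f * δ (sumℕ e) (sumℕ t)) (fallingV-other t e |e|≡|t| e≢t))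
                              (trans (cong (_* δ (sumℕ e) (sumℕ t)) (ℤP.*-zeroʳ c)) refl)
    ... | no  |e|≢|t| = trans (cong (c * fallingV t e *_) (δ-≢ _ _ |e|≢|t|)) (ℤP.*-zeroʳ (c * fallingV t e))

  sumℕ-+ : ∀ {d} (e e' : Vec ℕ d) → sumℕ (zipWith ℕ._+_ e e') ≡ sumℕ e ℕ.+ sumℕ e'
  sumℕ-+ []      []        = refl
  sumℕ-+ (m ∷ e) (n ∷ e') =
    trans (cong (ℕ._+_ (m ℕ.+ n)) (sumℕ-+ e e')) (ℕ+-interchange m n (sumℕ e) (sumℕ e'))

  sumℕ-0 : ∀ d → sumℕ (replicate d 0) ≡ 0
  sumℕ-0 zero    = refl
  sumℕ-0 (suc d) = sumℕ-0 d

  sumℕ-unit : ∀ {d} (i : Fin d) → sumℕ (unitVec i) ≡ 1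
  sumℕ-unit {suc d} zero    = cong suc (sumℕ-0 d)
  sumℕ-unit {suc d} (suc i) = sumℕ-unit i

  falling-suc : ∀ t e → falling t (e ℕ.+ 1) ≡ falling t e * (+ t - + e)
  falling-suc zero    zero    = refl
  falling-suc zero    (suc e) = refl
  falling-suc (suc t) zero    =
    trans (ℤP.*-identityʳ (+ suc t)) (sym (trans (ℤP.*-identityˡ (+ suc t - + 0)) (ℤP.+-identityʳ (+ suc t))))
  falling-suc (suc t) (suc e) =
    trans (cong (+ suc t *_) (falling-suc t e))
    (trans (sym (ℤP.*-assoc (+ suc t) (falling t e) _))
           (cong (+ suc t * falling t e *_) (sym (trans (ℤP.[1+m]⊖[1+n]≡m⊖n t e) (sym (ℤP.m-n≡m⊖n t e))))))

  fallingV-+unit : ∀ {d} (t e : Vec ℕ d) j →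
                   fallingV t (zipWith ℕ._+_ e (unitVec j)) ≡ fallingV t e * (+ lookup t j - + lookup e j)
  fallingV-+unit (t₀ ∷ t) (e₀ ∷ e) zero =
    trans (cong₂ _*_ (falling-suc t₀ e₀) (cong (fallingV t) (VecP.zipWith-identityʳ ℕP.+-identityʳ e)))
          (*-right-comm (falling t₀ e₀) _ (fallingV t e))
    where
    *-right-comm : ∀ a b c → a * b * c ≡ a * c * b
    *-right-comm = solve-∀
  fallingV-+unit (t₀ ∷ t) (e₀ ∷ e) (suc j) =
    trans (cong₂ _*_ (cong (falling t₀) (ℕP.+-identityʳ e₀)) (fallingV-+unit t e j))
          (sym (ℤP.*-assoc (falling t₀ e₀) _ _))

  sumF-differences : ∀ {d} (t e : Vec ℕ d) → sumF (λ j → + lookup t j - + lookup e j) ≡ + sumℕ t - + sumℕ e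
  sumF-differences []       []       = refl
  sumF-differences (t₀ ∷ t) (e₀ ∷ e) =
    trans (cong (_+_ (+ t₀ - + e₀)) (sumF-differences t e))
    (trans (regroup (+ t₀) (+ e₀) (+ sumℕ t) (+ sumℕ e))
           (sym (cong₂ _-_ (ℤP.pos-+ t₀ (sumℕ t)) (ℤP.pos-+ e₀ (sumℕ e)))))
    where
    regroup : ∀ a b c d → a - b + (c - d) ≡ a + c - (b + d)
    regroup = solve-∀

  Φ-·X : ∀ {d} m (t : Vec ℕ d) c e j →
         Φ (suc m) t ((c , e) · (+ 1 , unitVec j)) ≡ Φ m t (c , e) * (+ lookup t j - + lookup e j)
  Φ-·X m t c e j = begin
    c * + 1 * fallingV t (zipWith ℕ._+_ e (unitVec j)) * δ (sumℕ (zipWith ℕ._+_ e (unitVec j))) (suc m)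
      ≡⟨ cong₂ (λ f i → c * + 1 * f * i) (fallingV-+unit t e j) (cong (λ n → δ n (suc m)) |e+unit|) ⟩
    c * + 1 * (fallingV t e * (+ lookup t j - + lookup e j)) * δ (sumℕ e) m
      ≡⟨ rearrange c (fallingV t e) (+ lookup t j - + lookup e j) (δ (sumℕ e) m) ⟩
    c * fallingV t e * δ (sumℕ e) m * (+ lookup t j - + lookup e j)
      ∎
    where
    open ≡-Reasoning
    |e+unit| : sumℕ (zipWith ℕ._+_ e (unitVec j)) ≡ suc (sumℕ e)
    |e+unit| = trans (sumℕ-+ e (unitVec j)) (trans (cong (sumℕ e ℕ.+_) (sumℕ-unit j)) (ℕP.+-comm (sumℕ e) 1))
    rearrange : ∀ c f x i → c * + 1 * (f * x) * i ≡ c * f * i * x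
    rearrange = solve-∀

  -- A term of degree ≠ m has Φ m t-value 0, so |e| may be replaced by m.
  Φ-degree : ∀ {d} m (t : Vec ℕ d) c e →
             Φ m t (c , e) * (+ sumℕ t - + sumℕ e) ≡ Φ m t (c , e) * (+ sumℕ t - + m)
  Φ-degree m t c e with sumℕ e ℕ.≟ m
  ... | yes |e|≡m = cong (λ n → Φ m t (c , e) * (+ sumℕ t - + n)) |e|≡m
  ... | no  |e|≢m = trans (vanish (+ sumℕ t - + sumℕ e)) (sym (vanish (+ sumℕ t - + m)))
    where
    vanish : ∀ x → Φ m t (c , e) * x ≡ + 0
    vanish x = trans (cong (λ i → c * fallingV t e * i * x) (δ-≢ _ _ |e|≢m))
                     (trans (cong (_* x) (ℤP.*-zeroʳ (c * fallingV t e))) (ℤP.*-zeroˡ x))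

  Φ-*S : ∀ {d} m (t : Vec ℕ d) P → sumTerms (Φ (suc m) t) (P *P SP d) ≡ sumTerms (Φ m t) P * (+ sumℕ t - + m)
  Φ-*S {d} m t P =
    trans (sumTerms-*P (Φ (suc m) t) P (SP d))
          (trans (sumTerms-cong per-term P) (sumTerms-*ʳ (+ sumℕ t - + m) (Φ m t) P))
    where
    per-term : ∀ u → sumTerms (λ v → Φ (suc m) t (u · v)) (SP d) ≡ Φ m t u * (+ sumℕ t - + m)
    per-term (c , e) = begin
      sumTerms (λ v → Φ (suc m) t ((c , e) · v)) (SP d)
        ≡⟨ sumTerms-sumP (λ v → Φ (suc m) t ((c , e) · v)) (λ i → varP i) ⟩
      sumF (λ j → Φ (suc m) t ((c , e) · (+ 1 , unitVec j)) + + 0)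
        ≡⟨ sumF-cong (λ j → trans (ℤP.+-identityʳ _) (Φ-·X m t c e j)) ⟩
      sumF (λ j → Φ m t (c , e) * (+ lookup t j - + lookup e j))
        ≡⟨ sumF-* (Φ m t (c , e)) (λ j → + lookup t j - + lookup e j) ⟩
      Φ m t (c , e) * sumF (λ j → + lookup t j - + lookup e j)
        ≡⟨ cong (Φ m t (c , e) *_) (sumF-differences t e) ⟩
      Φ m t (c , e) * (+ sumℕ t - + sumℕ e)
        ≡⟨ Φ-degree m t c e ⟩
      Φ m t (c , e) * (+ sumℕ t - + m)
        ∎
      where open ≡-Reasoning

  Φ-*S^ : ∀ {d} n m (t : Vec ℕ d) P → sumℕ t ≡ m ℕ.+ n →
          sumTerms (Φ (sumℕ t) t) (P *P (SP d ^P n)) ≡ sumTerms (Φ m t) P * + fact n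
  Φ-*S^ {d} zero m t P |t|≡m+0 = begin
    sumTerms (Φ (sumℕ t) t) (P *P constP (+ 1)) ≡⟨ sumTerms-*P-1 (Φ (sumℕ t) t) P ⟩
    sumTerms (Φ (sumℕ t) t) P                   ≡⟨ cong (λ n → sumTerms (Φ n t) P) (trans |t|≡m+0 (ℕP.+-identityʳ m)) ⟩
    sumTerms (Φ m t) P                          ≡⟨ sym (ℤP.*-identityʳ _) ⟩
    sumTerms (Φ m t) P * + 1                    ∎
    where open ≡-Reasoning
  Φ-*S^ {d} (suc n) m t P |t|≡m+1+n = begin
    sumTerms (Φ (sumℕ t) t) (P *P (SP d *P (SP d ^P n)))
      ≡⟨ sym (sumTerms-*P-assoc (Φ (sumℕ t) t) P (SP d) (SP d ^P n)) ⟩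
    sumTerms (Φ (sumℕ t) t) ((P *P SP d) *P (SP d ^P n))
      ≡⟨ Φ-*S^ n (suc m) t (P *P SP d) (trans |t|≡m+1+n (ℕP.+-suc m n)) ⟩
    sumTerms (Φ (suc m) t) (P *P SP d) * + fact n
      ≡⟨ cong (_* + fact n) (Φ-*S m t P) ⟩
    sumTerms (Φ m t) P * (+ sumℕ t - + m) * + fact n
      ≡⟨ cong (λ k → sumTerms (Φ m t) P * k * + fact n) |t|-m≡1+n ⟩
    sumTerms (Φ m t) P * + suc n * + fact n
      ≡⟨ trans (ℤP.*-assoc (sumTerms (Φ m t) P) _ _) (cong (sumTerms (Φ m t) P *_) (sym (ℤP.pos-* (suc n) (fact n)))) ⟩
    sumTerms (Φ m t) P * + fact (suc n)
      ∎
    where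
    open ≡-Reasoning
    |t|-m≡1+n : + sumℕ t - + m ≡ + suc n
    |t|-m≡1+n = trans (cong (λ k → + k - + m) |t|≡m+1+n)
                      (trans (cong (_- + m) (ℤP.pos-+ m (suc n))) (cancel (+ m) (+ suc n)))
      where
      cancel : ∀ a b → a + b - a ≡ b
      cancel = solve-∀

  Homogeneous : ∀ {d} → ℕ → Poly d → Set
  Homogeneous n P = All (λ u → sumℕ (proj₂ u) ≡ n) P

  Φ-other-degree : ∀ {d} n m (t : Vec ℕ d) P → Homogeneous n P → n ≢ m → sumTerms (Φ m t) P ≡ + 0
  Φ-other-degree n m t []            []              n≢m = refl
  Φ-other-degree n m t ((c , e) ∷ P) (|e|≡n ∷ hom-P) n≢m =
    cong₂ _+_ (trans (cong (c * fallingV t e *_) (δ-≢ (sumℕ e) m (λ |e|≡m → n≢m (trans (sym |e|≡n) |e|≡m))))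
                     (ℤP.*-zeroʳ (c * fallingV t e)))
              (Φ-other-degree n m t P hom-P n≢m)

  homogeneous-*P : ∀ {d} a b (P Q : Poly d) → Homogeneous a P → Homogeneous b Q → Homogeneous (a ℕ.+ b) (P *P Q)
  homogeneous-*P a b []            Q []              hom-Q = []
  homogeneous-*P a b ((c , e) ∷ P) Q (|e|≡a ∷ hom-P) hom-Q =
    AllP.++⁺ (times-e Q hom-Q) (homogeneous-*P a b P Q hom-P hom-Q)
    where
    times-e : ∀ Q → Homogeneous b Q → Homogeneous (a ℕ.+ b) (map (λ { (c' , e') → (c * c' , zipWith ℕ._+_ e e') }) Q)
    times-e []               []               = []
    times-e ((c' , e') ∷ Q) (|e'|≡b ∷ hom-Q) = trans (sumℕ-+ e e') (cong₂ ℕ._+_ |e|≡a |e'|≡b) ∷ times-e Q hom-Q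

  homogeneous-sumP : ∀ {d n} k (f : Fin n → Poly d) → (∀ i → Homogeneous k (f i)) → Homogeneous k (sumP f)
  homogeneous-sumP {n = zero}  k f hom = []
  homogeneous-sumP {n = suc n} k f hom = AllP.++⁺ (hom zero) (homogeneous-sumP k (λ i → f (suc i)) (λ i → hom (suc i)))

  homogeneous-L : ∀ {d} (lam : Fin d → ℤ) → Homogeneous 1 (LP lam)
  homogeneous-L lam = homogeneous-sumP 1 (λ i → scaleP (lam i) (varP i)) (λ i → sumℕ-unit i ∷ [])

  homogeneous-const : ∀ {d} c → Homogeneous {d} 0 (constP c)
  homogeneous-const {d} c = sumℕ-0 d ∷ []

  homogeneous-Lχ : ∀ {d} (lam : Fin d → ℤ) χ → Homogeneous 1 (LP lam *P constP χ)
  homogeneous-Lχ lam χ = homogeneous-*P 1 0 (LP lam) (constP χ) (homogeneous-L lam) (homogeneous-const χ)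

  unitVec-diag : ∀ {d} (i : Fin d) → lookup (unitVec i) i ≡ 1
  unitVec-diag zero    = refl
  unitVec-diag (suc i) = unitVec-diag i

  unitVec-off : ∀ {d} (i j : Fin d) → j ≢ i → lookup (unitVec i) j ≡ 0
  unitVec-off {suc d} zero    zero    j≢i = ⊥-elim (j≢i refl)
  unitVec-off {suc d} zero    (suc j) j≢i = VecP.lookup-replicate j 0
  unitVec-off {suc d} (suc i) zero    j≢i = refl
  unitVec-off {suc d} (suc i) (suc j) j≢i = unitVec-off i j (λ j≡i → j≢i (cong suc j≡i))

  sumF-unitVec : ∀ {d} (lam : Fin d → ℤ) i → sumF (λ j → lam j * + lookup (unitVec i) j) ≡ lam i
  sumF-unitVec lam i =
    trans (sumF-single _ i (λ j j≢i → trans (cong (λ n → lam j * + n) (unitVec-off i j j≢i)) (ℤP.*-zeroʳ (lam j))))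
          (trans (cong (λ n → lam i * + n) (unitVec-diag i)) (ℤP.*-identityʳ (lam i)))

  fallingV-0 : ∀ {d} (t : Vec ℕ d) → fallingV t (replicate d 0) ≡ + 1
  fallingV-0 []      = refl
  fallingV-0 (_ ∷ t) = trans (ℤP.*-identityˡ _) (fallingV-0 t)

  fallingV-unit : ∀ {d} (t : Vec ℕ d) i → fallingV t (unitVec i) ≡ + lookup t i
  fallingV-unit (zero  ∷ t) zero    = refl
  fallingV-unit (suc n ∷ t) zero    = trans (cong (+ suc n * + 1 *_) (fallingV-0 t)) (trans (ℤP.*-identityʳ _) (ℤP.*-identityʳ _))
  fallingV-unit (n ∷ t)     (suc i) = trans (ℤP.*-identityˡ _) (fallingV-unit t i)

  -- The term λ_i X_i of L, as produced by scaleP.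
  λX : ∀ {d} → (Fin d → ℤ) → Fin d → Term d
  λX lam i = (lam i * + 1 , unitVec i)

  Φ-λX·λX : ∀ {d} (lam : Fin d → ℤ) (t : Vec ℕ d) i j →
            Φ 2 t (λX lam i · λX lam j) ≡
              lam i * + lookup t i * (lam j * + lookup t j - lam j * + lookup (unitVec i) j)
  Φ-λX·λX lam t i j = begin
    lam i * + 1 * (lam j * + 1) * fallingV t (zipWith ℕ._+_ (unitVec i) (unitVec j))
      * δ (sumℕ (zipWith ℕ._+_ (unitVec i) (unitVec j))) 2
      ≡⟨ cong₂ (λ f n → lam i * + 1 * (lam j * + 1) * f * δ n 2) (fallingV-+unit t (unitVec i) j) |eᵢ+eⱼ|≡2 ⟩
    lam i * + 1 * (lam j * + 1) * (fallingV t (unitVec i) * (+ lookup t j - + lookup (unitVec i) j)) * + 1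
      ≡⟨ cong (λ f → lam i * + 1 * (lam j * + 1) * (f * (+ lookup t j - + lookup (unitVec i) j)) * + 1)
              (fallingV-unit t i) ⟩
    lam i * + 1 * (lam j * + 1) * (+ lookup t i * (+ lookup t j - + lookup (unitVec i) j)) * + 1
      ≡⟨ rearrange (lam i) (lam j) (+ lookup t i) (+ lookup t j) (+ lookup (unitVec i) j) ⟩
    lam i * + lookup t i * (lam j * + lookup t j - lam j * + lookup (unitVec i) j)
      ∎
    where
    open ≡-Reasoning
    |eᵢ+eⱼ|≡2 : sumℕ (zipWith ℕ._+_ (unitVec i) (unitVec j)) ≡ 2
    |eᵢ+eⱼ|≡2 = trans (sumℕ-+ (unitVec i) (unitVec j)) (cong₂ ℕ._+_ (sumℕ-unit i) (sumℕ-unit j))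
    rearrange : ∀ a b x y z → a * + 1 * (b * + 1) * (x * (y - z)) * + 1 ≡ a * x * (b * y - b * z)
    rearrange = solve-∀

  Φ-λX·L : ∀ {d} (lam : Fin d → ℤ) (t : Vec ℕ d) i →
           sumTerms (λ v → Φ 2 t (λX lam i · v)) (LP lam) ≡
             lam i * + lookup t i * sumF (λ j → lam j * + lookup t j) - (lam i * lam i) * + lookup t i
  Φ-λX·L lam t i = begin
    sumTerms (λ v → Φ 2 t (λX lam i · v)) (LP lam)
      ≡⟨ sumTerms-sumP (λ v → Φ 2 t (λX lam i · v)) (λ j → scaleP (lam j) (varP j)) ⟩
    sumF (λ j → Φ 2 t (λX lam i · λX lam j) + + 0)
      ≡⟨ sumF-cong (λ j → trans (ℤP.+-identityʳ _) (Φ-λX·λX lam t i j)) ⟩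
    sumF (λ j → λtᵢ * (λt j - lam j * + lookup (unitVec i) j))
      ≡⟨ sumF-* λtᵢ (λ j → λt j - lam j * + lookup (unitVec i) j) ⟩
    λtᵢ * sumF (λ j → λt j - lam j * + lookup (unitVec i) j)
      ≡⟨ cong (λtᵢ *_) (trans (sumF-- λt (λ j → lam j * + lookup (unitVec i) j))
                              (cong (_-_ (sumF λt)) (sumF-unitVec lam i))) ⟩
    λtᵢ * (sumF λt - lam i)
      ≡⟨ expand (lam i) (+ lookup t i) (sumF λt) ⟩
    λtᵢ * sumF λt - (lam i * lam i) * + lookup t i
      ∎
    where
    open ≡-Reasoning
    λt = λ j → lam j * + lookup t j
    λtᵢ = λt i
    expand : ∀ a x T → a * x * (T - a) ≡ a * x * T - a * a * x
    expand = solve-∀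

  Φ-L² : ∀ {d} (lam : Fin d → ℤ) (t : Vec ℕ d) →
         sumTerms (Φ 2 t) (LP lam *P LP lam) ≡
           sumF (λ i → lam i * + lookup t i) * sumF (λ i → lam i * + lookup t i)
             - sumF (λ i → (lam i * lam i) * + lookup t i)
  Φ-L² {d} lam t = begin
    sumTerms (Φ 2 t) (LP lam *P LP lam)
      ≡⟨ sumTerms-*P (Φ 2 t) (LP lam) (LP lam) ⟩
    sumTerms (λ u → sumTerms (λ v → Φ 2 t (u · v)) (LP lam)) (LP lam)
      ≡⟨ sumTerms-sumP _ (λ i → scaleP (lam i) (varP i)) ⟩
    sumF (λ i → sumTerms (λ v → Φ 2 t (λX lam i · v)) (LP lam) + + 0)
      ≡⟨ sumF-cong (λ i → trans (ℤP.+-identityʳ _) (Φ-λX·L lam t i)) ⟩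
    sumF (λ i → λt i * T - λ²t i)
      ≡⟨ sumF-- (λ i → λt i * T) λ²t ⟩
    sumF (λ i → λt i * T) - sumF λ²t
      ≡⟨ cong (_- sumF λ²t) (trans (sumF-cong (λ i → ℤP.*-comm (λt i) T)) (sumF-* T λt)) ⟩
    T * T - sumF λ²t
      ∎
    where
    open ≡-Reasoning
    λt λ²t : Fin d → ℤ
    λt i = lam i * + lookup t i
    λ²t i = (lam i * lam i) * + lookup t i
    T = sumF λt

  Φ-L[L-χ] : ∀ {d} m (t : Vec ℕ d) (lam : Fin d → ℤ) χ →
             sumTerms (Φ m t) (LP lam *P (LP lam -P constP χ)) ≡
               sumTerms (Φ m t) (LP lam *P LP lam) + - + 1 * sumTerms (Φ m t) (LP lam *P constP χ)
  Φ-L[L-χ] m t lam χ =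
    trans (sumTerms-*P-++ (Φ m t) (LP lam) (LP lam) (scaleP (- + 1) (constP χ)))
          (cong (_+_ (sumTerms (Φ m t) (LP lam *P LP lam)))
                (sumTerms-*P-scale (Φ m t) (Φ-linear m t) (- + 1) (LP lam) (constP χ)))

  -- L² and L χ are homogeneous of degrees 2 and 1, so Φ m t M only sees L²
  -- when m = 2, and vanishes for m ∉ {1, 2}.
  Φ₂-L[L-χ] : ∀ {d} (t : Vec ℕ d) (lam : Fin d → ℤ) χ →
              sumTerms (Φ 2 t) (LP lam *P (LP lam -P constP χ)) ≡
                sumF (λ i → lam i * + lookup t i) * sumF (λ i → lam i * + lookup t i)
                  - sumF (λ i → (lam i * lam i) * + lookup t i)
  Φ₂-L[L-χ] t lam χ =
    trans (Φ-L[L-χ] 2 t lam χ)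
          (trans (cong (λ v → sumTerms (Φ 2 t) (LP lam *P LP lam) + - + 1 * v)
                       (Φ-other-degree 1 2 t (LP lam *P constP χ) (homogeneous-Lχ lam χ) (λ ())))
                 (trans (ℤP.+-identityʳ _) (Φ-L² lam t)))

  Φ-L[L-χ]-other-degree : ∀ {d} m (t : Vec ℕ d) (lam : Fin d → ℤ) χ → 1 ℕ.< m → 2 ≢ m →
                          sumTerms (Φ m t) (LP lam *P (LP lam -P constP χ)) ≡ + 0
  Φ-L[L-χ]-other-degree m t lam χ 1<m 2≢m =
    trans (Φ-L[L-χ] m t lam χ)
          (cong₂ (λ u v → u + - + 1 * v)
                 (Φ-other-degree 2 m t (LP lam *P LP lam) hom-L² 2≢m)
                 (Φ-other-degree 1 m t (LP lam *P constP χ) (homogeneous-Lχ lam χ) (ℕP.<⇒≢ 1<m)))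
    where
    hom-L² : Homogeneous 2 (LP lam *P LP lam)
    hom-L² = homogeneous-*P 1 1 (LP lam) (LP lam) (homogeneous-L lam) (homogeneous-L lam)

  -- Part two, exactly over ℤ: for |t| = p + 1,
  --   t! · coeff_t(Q) = (p − 1)! ((Σ λ_i t_i)² − Σ λ_i² t_i).
  -- With Q = M (S^(p−1) − 1):  Φ |t| (M S^(p−1)) = (p−1)! Φ 2 M  and  Φ |t| M = 0.
  coeff-Q : ∀ p {d} → 2 ℕ.≤ p → (lam : Fin d → ℤ) (χ : ℤ) (t : Vec ℕ d) → sumℕ t ≡ p ℕ.+ 1 →
            coeff t (Qpoly p lam χ) * factorials t ≡
              + fact (p ℕ.∸ 1) * ((sumF (λ i → lam i * + lookup t i) ^ℤ 2) - sumF (λ i → (lam i * lam i) * + lookup t i))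
  coeff-Q (suc (suc q)) {d} (s≤s (s≤s z≤n)) lam χ t |t|≡p+1 = begin
    coeff t (M *P (S^ ++ scaleP (- + 1) one)) * factorials t
      ≡⟨ coeff-via-Φ t (M *P (S^ ++ scaleP (- + 1) one)) ⟩
    Φ|t| (M *P (S^ ++ scaleP (- + 1) one))
      ≡⟨ sumTerms-*P-++ (Φ (sumℕ t) t) M S^ (scaleP (- + 1) one) ⟩
    Φ|t| (M *P S^) + Φ|t| (M *P scaleP (- + 1) one)
      ≡⟨ cong (_+_ (Φ|t| (M *P S^))) (sumTerms-*P-scale (Φ (sumℕ t) t) (Φ-linear (sumℕ t) t) (- + 1) M one) ⟩
    Φ|t| (M *P S^) + - + 1 * Φ|t| (M *P one)
      ≡⟨ cong₂ (λ u v → u + - + 1 * v) (Φ-*S^ (suc q) 2 t M (trans |t|≡p+1 (ℕP.+-comm (suc (suc q)) 1)))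
                                       (trans (sumTerms-*P-1 (Φ (sumℕ t) t) M) Φ|t|M≡0) ⟩
    sumTerms (Φ 2 t) M * + fact (suc q) + - + 1 * + 0
      ≡⟨ cong (λ u → u * + fact (suc q) + - + 1 * + 0) (Φ₂-L[L-χ] t lam χ) ⟩
    (T * T - Σλ²t) * + fact (suc q) + - + 1 * + 0
      ≡⟨ tidy T Σλ²t (+ fact (suc q)) ⟩
    + fact (suc q) * (T ^ℤ 2 - Σλ²t)
      ∎
    where
    open ≡-Reasoning
    M = LP lam *P (LP lam -P constP χ)
    S^ = SP d ^P suc q
    one : Poly d
    one = constP (+ 1)
    Φ|t| = sumTerms (Φ (sumℕ t) t)
    T = sumF (λ i → lam i * + lookup t i)
    Σλ²t = sumF (λ i → (lam i * lam i) * + lookup t i)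
    Φ|t|M≡0 : Φ|t| M ≡ + 0
    Φ|t|M≡0 = Φ-L[L-χ]-other-degree (sumℕ t) t lam χ
                (subst (1 ℕ.<_) (sym |t|≡p+1) (s≤s (s≤s z≤n)))
                (λ 2≡|t| → ℕP.<⇒≢ (s≤s (s≤s (ℕP.m≤n+m 1 q))) (trans 2≡|t| |t|≡p+1))
    tidy : ∀ T Σ F → (T * T - Σ) * F + - + 1 * + 0 ≡ F * ((T * (T * + 1)) - Σ)
    tidy = solve-∀

-- The theorem.
proposition4p3 : (p : ℕ) → Prime p →
    (ℓ : ℕ) → 1 ≤ ℓ →
    (a b : Fin ℓ → ℤ) →
    (∀ i → ¬ (a i ≡[ p ] + 0)) →
    (∀ (x : Fin ℓ → Bool) → InS p a x → InS p b x) →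
    (d : ℕ) (lam : Fin d → ℤ) → IsRatios p a b lam →
    2 ≤ d →
    (i0 j0 : Fin d) → i0 ≢ j0 →
    (k : Fin ℓ) → Iλ p a b (lam i0) k →
    let r = a k
        χ = (lam j0 - lam i0) * r
        Q = Qpoly p lam χ
    in ((x : Fin d → ℤ) →
          (∀ i → InSubsetSums p a (I' p a b lam i0 j0 k i) (x i)) →
          evalP x Q ≡[ p ] + 0)
       ×
       ((t : Vec ℕ d) → sumℕ t ≡ p ℕ.+ 1 → (∀ i → lookup t i < p) →
          IsQuot p (coeff t Q)
            (+ fact (p ℕ.∸ 1) *
              ((sumF (λ i → lam i * + lookup t i) ^ℤ 2)
                - sumF (λ i → (lam i * lam i) * + lookup t i)))
            (prodF (λ i → + fact (lookup t i))))
proposition4p3 p p-prime ℓ _ a b a≢0 𝒮A⊆𝒮B d lam ratios _ i0 j0 _ k k∈I₀ =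
  Vanishing.Q-vanishes p-prime a b a≢0 𝒮A⊆𝒮B lam ratios i0 j0 k k∈I₀ ,
  λ t |t|≡p+1 _ → ≈⇒≡[p] (≡⇒≈ (coeff-Q p 1<p lam _ t |t|≡p+1))
  where
  open Congruence p using (≈⇒≡[p]; ≡⇒≈)
  open Fermat p-prime using (1<p)
  open CoefficientFunctional using (coeff-Q)
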